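{- Let $\alpha,\beta$ be positive roots of $\Phi$ and suppose there is a saturated chain $\alpha=\gamma_0\gtrdot\gamma_1\gtrdot\cdots\gtrdot\gamma_k=\beta$ in the root poset of $\Phi$ that avoids cases (2) and (3) with respect to $x$, i.e. for every step with $\gamma_{j+1}=s_x(\gamma_j)$ one has $S_L(\gamma_j)=\gamma_j(x)$ or $S_R(\gamma_j)=\gamma_j(x)$. Then for every $n\ge1$ there is a saturated chain from $\mathrm{st}_n(\alpha)$ down to $\mathrm{st}_n(\beta)$ in the root poset of $\mathrm{st}_n(\Phi)$ which avoids cases (2) and (3) with respect to any vertex $x_i$ ($0\le i\le n$) of the stretched path, using the elastic data induced by $x_i$.
   Context: $\Phi$ is the root system of a crystallographic Cartan matrix $A$ for a Coxeter group with diagram $G$ (simple roots $\alpha_i$, $s_i(\beta)=\beta-(\alpha_i,\beta)\alpha_i$ with $(\alpha_i,\alpha_j)=A_{ij}$); roots are identified with integer-valued functions on vertices. Depth: $1+$ minimal $\ell$ in $\gamma=s_{y_\ell}\cdots s_{y_1}(\alpha_{y_0})$. Root poset: $\beta\le\gamma$ iff $\gamma=s_{i_k}\cdots s_{i_1}(\beta)$ with depth increasing by $1$ each step; covers are $\beta\lessdot s_i(\beta)$ with $s_i(\beta)-\beta$ a positive multiple of $\alpha_i$. Elastic data $(x,L_x,R_x)$: a vertex and partition of its neighbors. For a root $\delta$ and a diagram with elastic data $(v,L_v,R_v)$ and Cartan matrix $B$: $S_L(\delta)=\sum_{y\in L_v}-B_{vy}\delta(y)$, $S_R(\delta)=\sum_{z\in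 R_v}-B_{vz}\delta(z)$. A step $\delta\gtrdot s_v(\delta)$ of a chain is in case (1) if $S_L(\delta)=\delta(v)$ or $S_R(\delta)=\delta(v)$; cases (2) (both $<\delta(v)$) and (3) (one $>\delta(v)$) are the others; a chain avoids cases (2) and (3) with respect to $v$ if every step at $v$ is in case (1). $\mathrm{st}_n(G)$ replaces $x$ by a path $x_0-\cdots-x_n$ of unlabeled edges with $x_0$ joined to $L_x$ and $x_n$ to $R_x$; $\mathrm{st}_n(A)$ has entries $A_{yz}$ off the path, $A_{xz}$ at $(x_0,z)$ for $z\in L_x$ and $(x_n,z)$ for $z\in R_x$, $A_{yx}$ at $(y,x_0)$ for $y\in L_x$ and $(y,x_n)$ for $y\in R_x$, $2$ at $(x_i,x_i)$, $-1$ at $(x_i,x_{i\pm1})$, $0$ otherwise; $\mathrm{st}_n(\Phi)$ is its root system; $\mathrm{st}_n(\alpha)$ takes value $\alpha(x)$ at each $x_i$ and agrees with $\alpha$ elsewhere. Elastic data induced by $x_i$: $(x_0,L_x,\{x_1\})$ if $i=0$; $(x_i,\{x_{i-1}\},\{x_{i+1}\})$ if $0<i<n$; $(x_n,\{x_{n-1}\},R_x)$ if $i=n$. -}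

module Defs where

open import Data.Nat as ℕ using (ℕ; zero; suc)
open import Data.Integer as ℤ using (ℤ; _+_; _-_; _*_; -_; _≤_; _<_)
open import Data.Fin as Fin using (Fin; zero; suc; toℕ; splitAt; _↑ˡ_; _↑ʳ_)
open import Data.Bool using (Bool; true; false; if_then_else_; _∧_; _∨_)
open import Data.Sum using (_⊎_; inj₁; inj₂)
open import Data.Product using (Σ; _×_; _,_)
open import Data.Unit using (⊤)
open import Relation.Nullary using (¬_)
open import Relation.Nullary.Decidable using (⌊_⌋)
open import Relation.Binary.PropositionalEquality using (_≡_; _≢_; _≗_)

Mat : ℕ → Set
Mat m = Fin m → Fin m → ℤ

Vect : ℕ → Set
Vect m = Fin m → ℤ

∑ : ∀ {m} → (Fin m → ℤ) → ℤ
∑ {zero}  f = ℤ.0ℤ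
∑ {suc m} f = f zero + ∑ (λ i → f (suc i))

_==ᶠ_ : ∀ {m} → Fin m → Fin m → Bool
i ==ᶠ j = ⌊ i Fin.≟ j ⌋

_==ⁿ_ : ℕ → ℕ → Bool
a ==ⁿ b = ⌊ a ℕ.≟ b ⌋

IsCartan : ∀ {m} → Mat m → Set
IsCartan {m} A =
  (∀ i → A i i ≡ ℤ.+ 2) ×
  (∀ i j → i ≢ j → A i j ≤ ℤ.0ℤ) ×
  (∀ i j → A i j ≡ ℤ.0ℤ → A j i ≡ ℤ.0ℤ)

Neighbour : ∀ {m} → Mat m → Fin m → Fin m → Set
Neighbour A x y = (y ≢ x) × (A x y ≢ ℤ.0ℤ)

IsElastic : ∀ {m} → Mat m → Fin m → (Fin m → Bool) → (Fin m → Bool) → Set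
IsElastic A x L R = ∀ y →
  (L y ≡ true → Neighbour A x y) ×
  (R y ≡ true → Neighbour A x y) ×
  (Neighbour A x y → (L y ≡ true) ⊎ (R y ≡ true)) ×
  ¬ ((L y ≡ true) × (R y ≡ true))

simple : ∀ {m} → Fin m → Vect m
simple i u = if u ==ᶠ i then ℤ.1ℤ else ℤ.0ℤ

pairing : ∀ {m} → Mat m → Fin m → Vect m → ℤ
pairing A i β = ∑ (λ j → A i j * β j)

refl : ∀ {m} → Mat m → Fin m → Vect m → Vect m
refl A i β u = β u - pairing A i β * simple i u

data IsRoot {m} (A : Mat m) : Vect m → Set where
  simpleRoot : ∀ i {γ} → γ ≗ simple i → IsRoot A γ
  reflRoot   : ∀ i {γ δ} → IsRoot A γ → δ ≗ refl A i γ → IsRoot A δ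

PosRoot : ∀ {m} → Mat m → Vect m → Set
PosRoot A γ = IsRoot A γ × (∀ u → ℤ.0ℤ ≤ γ u)

Covers : ∀ {m} → Mat m → Vect m → Vect m → Set
Covers {m} A γ δ =
  PosRoot A γ × PosRoot A δ ×
  Σ (Fin m) λ v → (γ ≗ refl A v δ) ×
    Σ ℤ λ c → (ℤ.0ℤ < c) × (∀ u → γ u - δ u ≡ c * simple v u)

data Chain {m} (A : Mat m) : Vect m → Vect m → Set where
  done : ∀ {γ ε} → PosRoot A γ → γ ≗ ε → Chain A γ ε
  step : ∀ {γ δ ε} → Covers A γ δ → Chain A δ ε → Chain A γ ε

S : ∀ {m} → Mat m → Fin m → (Fin m → Bool) → Vect m → ℤ
S B v L δ = ∑ (λ y → if L y then - (B v y) * δ y else ℤ.0ℤ)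

Case1 : ∀ {m} → Mat m → Fin m → (Fin m → Bool) → (Fin m → Bool) → Vect m → Set
Case1 B v L R δ = (S B v L δ ≡ δ v) ⊎ (S B v R δ ≡ δ v)

Avoids : ∀ {m} (B : Mat m) → Fin m → (Fin m → Bool) → (Fin m → Bool) →
         ∀ {γ ε} → Chain B γ ε → Set
Avoids B v L R (done _ _) = ⊤
Avoids B v L R (step {γ} {δ} _ ch) =
  (δ ≗ refl B v γ → Case1 B v L R γ) × Avoids B v L R ch

-- The vertex set of st_n(G) is encoded as Fin (m + n):
--   splitAt m u = inj₁ y , y ≠ x   : the old vertex y
--   splitAt m u = inj₁ x           : the path vertex x₀
--   splitAt m u = inj₂ k           : the path vertex x_{k+1}

decode : ∀ {m} n → Fin m → Fin (m ℕ.+ n) → Fin m ⊎ Fin (suc n)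
decode {m} n x u with splitAt m u
... | inj₁ y = if y ==ᶠ x then inj₂ zero else inj₁ y
... | inj₂ k = inj₂ (suc k)

pathV : ∀ {m} n → Fin m → Fin (suc n) → Fin (m ℕ.+ n)
pathV n x zero    = x ↑ˡ n
pathV {m} n x (suc k) = m ↑ʳ k

adjⁿ : ℕ → ℕ → Bool
adjⁿ a b = (a ==ⁿ suc b) ∨ (b ==ⁿ suc a)

pathOld : ∀ {m} n → Mat m → Fin m → (Fin m → Bool) → (Fin m → Bool) →
          Fin (suc n) → Fin m → ℤ
pathOld n A x L R i z =
  if ((toℕ i ==ⁿ 0) ∧ L z) ∨ ((toℕ i ==ⁿ n) ∧ R z) then A x z else ℤ.0ℤ

oldPath : ∀ {m} n → Mat m → Fin m → (Fin m → Bool) → (Fin m → Bool) →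
          Fin m → Fin (suc n) → ℤ
oldPath n A x L R y j =
  if ((toℕ j ==ⁿ 0) ∧ L y) ∨ ((toℕ j ==ⁿ n) ∧ R y) then A y x else ℤ.0ℤ

pathPath : ∀ {n} → Fin (suc n) → Fin (suc n) → ℤ
pathPath i j =
  if toℕ i ==ⁿ toℕ j then ℤ.+ 2
  else if adjⁿ (toℕ i) (toℕ j) then ℤ.-1ℤ else ℤ.0ℤ

stA : ∀ {m} n → Mat m → Fin m → (Fin m → Bool) → (Fin m → Bool) → Mat (m ℕ.+ n)
stA n A x L R u w with decode n x u | decode n x w
... | inj₁ y | inj₁ z = A y z
... | inj₁ y | inj₂ j = oldPath n A x L R y j
... | inj₂ i | inj₁ z = pathOld n A x L R i z
... | inj₂ i | inj₂ j = pathPath i j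

stRoot : ∀ {m} n → Fin m → Vect m → Vect (m ℕ.+ n)
stRoot n x α u with decode n x u
... | inj₁ y = α y
... | inj₂ _ = α x

inducedL : ∀ {m} n → Fin m → (Fin m → Bool) → Fin (suc n) → Fin (m ℕ.+ n) → Bool
inducedL n x L i u with decode n x u
... | inj₁ z = (toℕ i ==ⁿ 0) ∧ L z
... | inj₂ j = suc (toℕ j) ==ⁿ toℕ i

inducedR : ∀ {m} n → Fin m → (Fin m → Bool) → Fin (suc n) → Fin (m ℕ.+ n) → Bool
inducedR n x R i u with decode n x u
... | inj₁ z = (toℕ i ==ⁿ n) ∧ R z
... | inj₂ j = toℕ j ==ⁿ suc (toℕ i)

-- Write a vector on st_n(G) as a pair (f, g): f on the old vertices and g(i) at x_i, so that st_n(α)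
-- is (α, const α(x)).  At an old vertex v ≠ x pairing and reflection commute with st_n, so a step of
-- the chain at v lifts to the single step at v.  A step γ ⋗ s_x(γ) has q = 2γ(x) − S_L(γ) − S_R(γ) > 0;
-- if S_L(γ) = γ(x), then S_R(γ) = γ(x) − q and the step lifts to the reflections at x_n, x_{n−1}, …, x_0.
-- Before reflecting at x_k the path carries γ(x) on x_0, …, x_k and γ(x) − q beyond, so the neighbour
-- on the left of x_k contributes γ(x) (S_L(γ) when k = 0), the one on the right γ(x) − q (S_R(γ) when
-- k = n); by the elastic identity (α_v, δ) = 2δ(v) − S_L(δ) − S_R(δ), applied to the data induced by
-- x_k, the pairing is again q, and S_L equals the value at x_k, i.e. every new step is in case (1).
-- The case S_R(γ) = γ(x) sweeps x_0, …, x_n instead.  Roots lift to roots because st_n(α_x) is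
-- s_{x_0}⋯s_{x_{n−1}}(α_{x_n}) and s_x lifts to s_{x_0}⋯s_{x_{n−1}} s_{x_n} s_{x_{n−1}}⋯s_{x_0}.

module Submission where

open import Defs renaming (refl to reflect)
open import Data.Nat as ℕ using (ℕ; zero; suc; _≤_; s≤s)
import Data.Nat.Properties as ℕP
open import Data.Integer as ℤ using (ℤ; _+_; _-_; _*_; -_; 0ℤ; 1ℤ)
import Data.Integer.Properties as ℤP
open import Data.Integer.Tactic.RingSolver using (solve-∀)
open import Data.Fin as Fin using (Fin; zero; suc; toℕ; _↑ˡ_; _↑ʳ_; punchIn)
import Data.Fin.Properties as FinP
open import Data.Fin.Induction using (<-weakInduction; >-weakInduction)
open import Data.Bool using (Bool; true; false; if_then_else_; _∧_; _∨_)
import Data.Bool.Properties as BoolP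
open import Data.Sum using (_⊎_; inj₁; inj₂; [_,_])
open import Data.Product using (Σ; _×_; _,_; proj₁; proj₂)
open import Data.Unit using (tt)
open import Function using (_∘_)
open import Relation.Nullary using (¬_; yes; no; contradiction)
open import Relation.Nullary.Decidable using (dec-true; dec-false; isYes≗does)
open import Relation.Binary.Definitions using (tri<; tri≈; tri>)
open import Relation.Binary.PropositionalEquality
  using (_≡_; _≢_; _≗_; refl; sym; trans; cong; cong₂; subst; module ≡-Reasoning)
open import Algebra.Properties.Semiring.Sum ℤP.+-*-semiring
  using (sum; sum-cong-≗; sum-replicate-zero; sum-remove; *-distribˡ-sum)
  renaming (∑-distrib-+ to sum-distrib-+)

open ≡-Reasoning

-- Finite sums

∑≡sum : ∀ {m} (f : Fin m → ℤ) → ∑ f ≡ sum f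
∑≡sum {zero}  f = refl
∑≡sum {suc m} f = cong (f zero +_) (∑≡sum (f ∘ suc))

∑-cong : ∀ {m} {f g : Fin m → ℤ} → f ≗ g → ∑ f ≡ ∑ g
∑-cong {f = f} {g} f≗g = trans (∑≡sum f) (trans (sum-cong-≗ f≗g) (sym (∑≡sum g)))

∑-distrib-+ : ∀ {m} (f g : Fin m → ℤ) → ∑ (λ i → f i + g i) ≡ ∑ f + ∑ g
∑-distrib-+ f g = begin
  ∑ (λ i → f i + g i)  ≡⟨ ∑≡sum (λ i → f i + g i) ⟩
  sum (λ i → f i + g i) ≡⟨ sum-distrib-+ f g ⟩
  sum f + sum g         ≡⟨ sym (cong₂ _+_ (∑≡sum f) (∑≡sum g)) ⟩
  ∑ f + ∑ g             ∎

*-distribˡ-∑ : ∀ {m} c (f : Fin m → ℤ) → c * ∑ f ≡ ∑ (λ i → c * f i)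
*-distribˡ-∑ c f = begin
  c * ∑ f               ≡⟨ cong (c *_) (∑≡sum f) ⟩
  c * sum f             ≡⟨ *-distribˡ-sum c f ⟩
  sum (λ i → c * f i)   ≡⟨ sym (∑≡sum (λ i → c * f i)) ⟩
  ∑ (λ i → c * f i)     ∎

∑-zero : ∀ {m} {f : Fin m → ℤ} → (∀ i → f i ≡ 0ℤ) → ∑ f ≡ 0ℤ
∑-zero {m} f≡0 = trans (∑-cong f≡0) (trans (∑≡sum {m} (λ _ → 0ℤ)) (sum-replicate-zero m))

∑-remove : ∀ {m} (x : Fin (suc m)) (f : Fin (suc m) → ℤ) → ∑ f ≡ f x + ∑ (f ∘ punchIn x)
∑-remove x f = trans (∑≡sum f) (trans (sum-remove f) (cong (f x +_) (sym (∑≡sum (f ∘ punchIn x)))))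

∑-single : ∀ {m} (x : Fin m) (f : Fin m → ℤ) → (∀ y → y ≢ x → f y ≡ 0ℤ) → ∑ f ≡ f x
∑-single {suc m} x f f≡0 = begin
  ∑ f                       ≡⟨ ∑-remove x f ⟩
  f x + ∑ (f ∘ punchIn x)   ≡⟨ cong (f x +_) (∑-zero (λ j → f≡0 _ (FinP.punchInᵢ≢i x j))) ⟩
  f x + 0ℤ                  ≡⟨ ℤP.+-identityʳ (f x) ⟩
  f x                       ∎

∑-update : ∀ {m} (x : Fin m) (f g : Fin m → ℤ) → (∀ y → y ≢ x → g y ≡ f y) →
           ∑ g + f x ≡ ∑ f + g x
∑-update {suc m} x f g g≡f = begin
  ∑ g + f x                     ≡⟨ cong (_+ f x) (∑-remove x g) ⟩
  g x + ∑ (g ∘ punchIn x) + f x ≡⟨ cong (λ s → g x + s + f x) (∑-cong (λ j → g≡f _ (FinP.punchInᵢ≢i x j))) ⟩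
  g x + ∑ (f ∘ punchIn x) + f x ≡⟨ swap (g x) _ (f x) ⟩
  f x + ∑ (f ∘ punchIn x) + g x ≡⟨ cong (_+ g x) (sym (∑-remove x f)) ⟩
  ∑ f + g x                     ∎
  where swap : ∀ a s b → a + s + b ≡ b + s + a
        swap = solve-∀

∑-↑ : ∀ m {n} (f : Fin (m ℕ.+ n) → ℤ) → ∑ f ≡ ∑ (λ y → f (y ↑ˡ n)) + ∑ (λ k → f (m ↑ʳ k))
∑-↑ zero    f = sym (ℤP.+-identityˡ _)
∑-↑ (suc m) f = trans (cong (f zero +_) (∑-↑ m (f ∘ suc))) (sym (ℤP.+-assoc (f zero) _ _))

∑-if : ∀ {m} (b : Bool) (f : Fin m → ℤ) → ∑ (λ i → if b then f i else 0ℤ) ≡ (if b then ∑ f else 0ℤ)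
∑-if true  f = refl
∑-if {m} false f = ∑-zero {m} (λ _ → refl)

==ᶠ-≡ : ∀ {m} {u w : Fin m} → u ≡ w → (u ==ᶠ w) ≡ true
==ᶠ-≡ {u = u} {w} u≡w = trans (isYes≗does (u Fin.≟ w)) (dec-true (u Fin.≟ w) u≡w)

==ᶠ-≢ : ∀ {m} {u w : Fin m} → u ≢ w → (u ==ᶠ w) ≡ false
==ᶠ-≢ {u = u} {w} u≢w = trans (isYes≗does (u Fin.≟ w)) (dec-false (u Fin.≟ w) u≢w)

==ⁿ-≡ : ∀ {a b} → a ≡ b → (a ==ⁿ b) ≡ true
==ⁿ-≡ {a} {b} a≡b = trans (isYes≗does (a ℕ.≟ b)) (dec-true (a ℕ.≟ b) a≡b)

==ⁿ-≢ : ∀ {a b} → a ≢ b → (a ==ⁿ b) ≡ false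
==ⁿ-≢ {a} {b} a≢b = trans (isYes≗does (a ℕ.≟ b)) (dec-false (a ℕ.≟ b) a≢b)

==ⁿ⇒≡ : ∀ a b → (a ==ⁿ b) ≡ true → a ≡ b
==ⁿ⇒≡ a b eq with a ℕ.≟ b
... | yes a≡b = a≡b
==ⁿ⇒≡ a b () | no _

==ⁿ-sym : ∀ a b → (a ==ⁿ b) ≡ (b ==ⁿ a)
==ⁿ-sym a b with a ℕ.≟ b
... | yes a≡b = sym (==ⁿ-≡ (sym a≡b))
... | no a≢b  = sym (==ⁿ-≢ (a≢b ∘ sym))

==ⁿ-suc : ∀ a b → (suc a ==ⁿ suc b) ≡ (a ==ⁿ b)
==ⁿ-suc a b with a ℕ.≟ b
... | yes a≡b = ==ⁿ-≡ (cong suc a≡b)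
... | no a≢b  = ==ⁿ-≢ (a≢b ∘ ℕP.suc-injective)

<ᵇ-true : ∀ {a b} → a ℕ.< b → (a ℕ.<ᵇ b) ≡ true
<ᵇ-true {zero}  {suc b} _         = refl
<ᵇ-true {suc a} {suc b} (s≤s a<b) = <ᵇ-true a<b

<ᵇ-false : ∀ {a b} → b ≤ a → (a ℕ.<ᵇ b) ≡ false
<ᵇ-false {a}     {zero}  _         = refl
<ᵇ-false {suc a} {suc b} (s≤s b≤a) = <ᵇ-false b≤a

∑-at : ∀ {N} (j₀ : Fin N) {c} (h : Fin N → ℤ) → toℕ j₀ ≡ c → ∑ (λ j → if toℕ j ==ⁿ c then h j else 0ℤ) ≡ h j₀
∑-at j₀ h refl = trans (∑-single j₀ _ vanish) (cong (λ b → if b then h j₀ else 0ℤ) (==ⁿ-≡ refl))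
  where vanish : ∀ j → j ≢ j₀ → (if toℕ j ==ⁿ toℕ j₀ then h j else 0ℤ) ≡ 0ℤ
        vanish j j≢j₀ = cong (λ b → if b then h j else 0ℤ) (==ⁿ-≢ (j≢j₀ ∘ FinP.toℕ-injective))

∑-nowhere : ∀ {N} {c} (h : Fin N → ℤ) → (∀ j → toℕ j ≢ c) → ∑ (λ j → if toℕ j ==ⁿ c then h j else 0ℤ) ≡ 0ℤ
∑-nowhere h never = ∑-zero (λ j → cong (λ b → if b then h j else 0ℤ) (==ⁿ-≢ (never j)))

simple-self : ∀ {m} (w : Fin m) → simple w w ≡ 1ℤ
simple-self w = cong (λ b → if b then 1ℤ else 0ℤ) (==ᶠ-≡ refl)

simple-≢ : ∀ {m} {u w : Fin m} → u ≢ w → simple w u ≡ 0ℤ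
simple-≢ u≢w = cong (λ b → if b then 1ℤ else 0ℤ) (==ᶠ-≢ u≢w)

-- Roots, reflections and elastic data

elastic-L-self : ∀ {m} {B : Mat m} {v L R} → IsElastic B v L R → L v ≡ false
elastic-L-self {v = v} {L} elastic with L v in Lv
... | true  = contradiction refl (proj₁ (proj₁ (elastic v) Lv))
... | false = refl

elastic-R-self : ∀ {m} {B : Mat m} {v L R} → IsElastic B v L R → R v ≡ false
elastic-R-self {v = v} {R = R} elastic with R v in Rv
... | true  = contradiction refl (proj₁ (proj₁ (proj₂ (elastic v)) Rv))
... | false = refl

elastic-outside : ∀ {m} {B : Mat m} {v L R y} → IsElastic B v L R → y ≢ v → L y ≡ false → R y ≡ false → B v y ≡ 0ℤ
elastic-outside {B = B} {v} {y = y} elastic y≢v Ly Ry with B v y ℤ.≟ 0ℤ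
... | yes Bvy≡0 = Bvy≡0
... | no Bvy≢0 with proj₁ (proj₂ (proj₂ (elastic y))) (y≢v , Bvy≢0)
...   | inj₁ Ly′ = contradiction (trans (sym Ly′) Ly) λ ()
...   | inj₂ Ry′ = contradiction (trans (sym Ry′) Ry) λ ()

simple-↑ˡ : ∀ {m} n (y v : Fin m) → simple (v ↑ˡ n) (y ↑ˡ n) ≡ simple v y
simple-↑ˡ n y v with y Fin.≟ v
... | yes refl = simple-self (v ↑ˡ n)
... | no y≢v   = simple-≢ (y≢v ∘ FinP.↑ˡ-injective n y v)

module RootSystem {m} (B : Mat m) where

  pairing-cong : ∀ w {Γ Δ : Vect m} → Γ ≗ Δ → pairing B w Γ ≡ pairing B w Δ
  pairing-cong w Γ≗Δ = ∑-cong (λ u → cong (B w u *_) (Γ≗Δ u))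

  reflect-cong : ∀ w {Γ Δ : Vect m} → Γ ≗ Δ → reflect B w Γ ≗ reflect B w Δ
  reflect-cong w Γ≗Δ u = cong₂ (λ a p → a - p * simple w u) (Γ≗Δ u) (pairing-cong w Γ≗Δ)

  S-cong : ∀ v L {Γ Δ : Vect m} → Γ ≗ Δ → S B v L Γ ≡ S B v L Δ
  S-cong v L Γ≗Δ = ∑-cong (λ y → cong (λ a → if L y then - B v y * a else 0ℤ) (Γ≗Δ y))

  Case1-cong : ∀ v L R {Γ Δ : Vect m} → Γ ≗ Δ → Case1 B v L R Δ → Case1 B v L R Γ
  Case1-cong v L R Γ≗Δ (inj₁ SL≡) = inj₁ (trans (S-cong v L Γ≗Δ) (trans SL≡ (sym (Γ≗Δ v))))
  Case1-cong v L R Γ≗Δ (inj₂ SR≡) = inj₂ (trans (S-cong v R Γ≗Δ) (trans SR≡ (sym (Γ≗Δ v))))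

  IsRoot-cong : ∀ {Γ Δ : Vect m} → IsRoot B Γ → Δ ≗ Γ → IsRoot B Δ
  IsRoot-cong (simpleRoot i Γ≗αᵢ) Δ≗Γ = simpleRoot i (λ u → trans (Δ≗Γ u) (Γ≗αᵢ u))
  IsRoot-cong (reflRoot i r Γ≗sᵢ) Δ≗Γ = reflRoot i r (λ u → trans (Δ≗Γ u) (Γ≗sᵢ u))

  reflect-self : ∀ w (Γ : Vect m) → reflect B w Γ w ≡ Γ w - pairing B w Γ
  reflect-self w Γ = trans (cong (λ s → Γ w - pairing B w Γ * s) (simple-self w)) (lemma (Γ w) (pairing B w Γ))
    where lemma : ∀ g p → g - p * 1ℤ ≡ g - p
          lemma = solve-∀

  reflect-other : ∀ w (Γ : Vect m) {u} → u ≢ w → reflect B w Γ u ≡ Γ u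
  reflect-other w Γ {u} u≢w = trans (cong (λ s → Γ u - pairing B w Γ * s) (simple-≢ u≢w)) (lemma (Γ u) (pairing B w Γ))
    where lemma : ∀ g p → g - p * 0ℤ ≡ g
          lemma = solve-∀

  S-simple : ∀ {v L R} → IsElastic B v L R → S B v L (simple v) ≡ 0ℤ
  S-simple {v} {L} elastic = ∑-zero term
    where
      term : ∀ y → (if L y then - B v y * simple v y else 0ℤ) ≡ 0ℤ
      term y with L y in Ly
      ... | false = refl
      ... | true  = trans (cong (- B v y *_) (simple-≢ y≢v)) (ℤP.*-zeroʳ (- B v y))
        where y≢v : y ≢ v
              y≢v refl = contradiction (trans (sym Ly) (elastic-L-self {B = B} elastic)) λ ()

  pairing-simple : ∀ w → pairing B w (simple w) ≡ B w w
  pairing-simple w = begin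
    ∑ (λ u → B w u * simple w u)
      ≡⟨ ∑-single w (λ u → B w u * simple w u)
                  (λ u u≢w → trans (cong (B w u *_) (simple-≢ u≢w)) (ℤP.*-zeroʳ (B w u))) ⟩
    B w w * simple w w           ≡⟨ cong (B w w *_) (simple-self w) ⟩
    B w w * 1ℤ                   ≡⟨ ℤP.*-identityʳ (B w w) ⟩
    B w w                        ∎

  pairing-reflect : ∀ w (Γ : Vect m) → pairing B w (reflect B w Γ) ≡ pairing B w Γ - pairing B w Γ * B w w
  pairing-reflect w Γ = trans (cancel (pairing B w (reflect B w Γ)) (P * B w w)) (cong (_- P * B w w) total)
    where
      P = pairing B w Γ
      cancel : ∀ r s → r ≡ r + s - s
      cancel = solve-∀
      expand : ∀ u → B w u * reflect B w Γ u + P * (B w u * simple w u) ≡ B w u * Γ u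
      expand u = lemma (B w u) (Γ u) P (simple w u)
        where lemma : ∀ b g p s → b * (g - p * s) + p * (b * s) ≡ b * g
              lemma = solve-∀
      total : pairing B w (reflect B w Γ) + P * B w w ≡ P
      total = begin
        pairing B w (reflect B w Γ) + P * B w w
          ≡⟨ cong (λ z → pairing B w (reflect B w Γ) + P * z) (sym (pairing-simple w)) ⟩
        pairing B w (reflect B w Γ) + P * ∑ (λ u → B w u * simple w u)
          ≡⟨ cong (pairing B w (reflect B w Γ) +_) (*-distribˡ-∑ P (λ u → B w u * simple w u)) ⟩
        pairing B w (reflect B w Γ) + ∑ (λ u → P * (B w u * simple w u))
          ≡⟨ sym (∑-distrib-+ (λ u → B w u * reflect B w Γ u) (λ u → P * (B w u * simple w u))) ⟩
        ∑ (λ u → B w u * reflect B w Γ u + P * (B w u * simple w u))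
          ≡⟨ ∑-cong expand ⟩
        P ∎

  reflect-involutive : ∀ w {Γ Δ : Vect m} → B w w ≡ ℤ.+ 2 → Δ ≗ reflect B w Γ → Γ ≗ reflect B w Δ
  reflect-involutive w {Γ} {Δ} Bww≡2 Δ≗sΓ u = begin
    Γ u                                               ≡⟨ lemma (Γ u) P (simple w u) ⟩
    (Γ u - P * simple w u) - (P - P * ℤ.+ 2) * simple w u
      ≡⟨ cong₂ (λ a q → a - q * simple w u) (sym (Δ≗sΓ u)) (sym pairingΔ) ⟩
    Δ u - pairing B w Δ * simple w u                  ∎
    where
      P = pairing B w Γ
      lemma : ∀ g p s → g ≡ (g - p * s) - (p - p * ℤ.+ 2) * s
      lemma = solve-∀
      pairingΔ : pairing B w Δ ≡ P - P * ℤ.+ 2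
      pairingΔ = trans (pairing-cong w Δ≗sΓ) (trans (pairing-reflect w Γ) (cong (λ b → P - P * b) Bww≡2))

  reflect-difference : ∀ w {Γ Δ : Vect m} → Δ ≗ reflect B w Γ → ∀ u → Γ u - Δ u ≡ pairing B w Γ * simple w u
  reflect-difference w {Γ} Δ≗sΓ u = trans (cong (λ d → Γ u - d) (Δ≗sΓ u)) (lemma (Γ u) (pairing B w Γ) (simple w u))
    where lemma : ∀ g p s → g - (g - p * s) ≡ p * s
          lemma = solve-∀

  cover-pairing : ∀ v {Γ Δ : Vect m} {c} → Δ ≗ reflect B v Γ → (∀ u → Γ u - Δ u ≡ c * simple v u) → pairing B v Γ ≡ c
  cover-pairing v {Γ} {Δ} {c} Δ≗sΓ diff = begin
    pairing B v Γ              ≡⟨ sym (ℤP.*-identityʳ _) ⟩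
    pairing B v Γ * 1ℤ         ≡⟨ cong (pairing B v Γ *_) (sym (simple-self v)) ⟩
    pairing B v Γ * simple v v ≡⟨ sym (reflect-difference v Δ≗sΓ v) ⟩
    Γ v - Δ v                  ≡⟨ diff v ⟩
    c * simple v v             ≡⟨ cong (c *_) (simple-self v) ⟩
    c * 1ℤ                     ≡⟨ ℤP.*-identityʳ c ⟩
    c                          ∎

  cover-reflection : ∀ v {Γ Δ : Vect m} {c} → B v v ≡ ℤ.+ 2 → Γ ≗ reflect B v Δ →
                     (∀ u → Γ u - Δ u ≡ c * simple v u) → 0ℤ ℤ.< c →
                     (Δ ≗ reflect B v Γ) × (0ℤ ℤ.< pairing B v Γ)
  cover-reflection v Bvv≡2 Γ≗sΔ diff c>0 =
    Δ≗sΓ , subst (0ℤ ℤ.<_) (sym (cover-pairing v Δ≗sΓ diff)) c>0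
    where Δ≗sΓ = reflect-involutive v Bvv≡2 Γ≗sΔ

  reflection-vertex : ∀ {v w} {Γ Δ : Vect m} {c} → (∀ u → Γ u - Δ u ≡ c * simple w u) → 0ℤ ℤ.< c →
                      Δ ≗ reflect B v Γ → v ≡ w
  reflection-vertex {v} {w} {Γ} {Δ} {c} diff c>0 Δ≗sΓ with v Fin.≟ w
  ... | yes v≡w = v≡w
  ... | no v≢w = contradiction c>0 (ℤP.<-irrefl (sym c≡0))
    where
      c≡0 : c ≡ 0ℤ
      c≡0 = begin
        c                          ≡⟨ sym (ℤP.*-identityʳ c) ⟩
        c * 1ℤ                     ≡⟨ cong (c *_) (sym (simple-self w)) ⟩
        c * simple w w             ≡⟨ sym (diff w) ⟩
        Γ w - Δ w                  ≡⟨ reflect-difference v Δ≗sΓ w ⟩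
        pairing B v Γ * simple v w ≡⟨ cong (pairing B v Γ *_) (simple-≢ (v≢w ∘ sym)) ⟩
        pairing B v Γ * 0ℤ         ≡⟨ ℤP.*-zeroʳ (pairing B v Γ) ⟩
        0ℤ                         ∎

  reflection-cover : ∀ w {Γ Δ : Vect m} → B w w ≡ ℤ.+ 2 → PosRoot B Γ → (∀ u → 0ℤ ℤ.≤ Δ u) →
                     Δ ≗ reflect B w Γ → 0ℤ ℤ.< pairing B w Γ → Covers B Γ Δ
  reflection-cover w {Γ} Bww≡2 posΓ Δ≥0 Δ≗sΓ pos =
    posΓ , (reflRoot w (proj₁ posΓ) Δ≗sΓ , Δ≥0) , w , reflect-involutive w Bww≡2 Δ≗sΓ ,
    pairing B w Γ , pos , reflect-difference w Δ≗sΓ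

  chain-head : ∀ {Γ E : Vect m} → Chain B Γ E → PosRoot B Γ
  chain-head (done posΓ _) = posΓ
  chain-head (step cover _) = proj₁ cover

  AvoidsAll : ∀ {I : Set} → (I → Fin m) → (I → Fin m → Bool) → (I → Fin m → Bool) →
              ∀ {Γ E : Vect m} → Chain B Γ E → Set
  AvoidsAll v Ls Rs ch = ∀ i → Avoids B (v i) (Ls i) (Rs i) ch

  prepend-reflection : ∀ {I : Set} {v : I → Fin m} {Ls Rs : I → Fin m → Bool} w {Γ Δ E : Vect m} →
    B w w ≡ ℤ.+ 2 → (∀ u → 0ℤ ℤ.≤ Γ u) → Δ ≗ reflect B w Γ → 0ℤ ℤ.< pairing B w Γ →
    (∀ i → v i ≡ w → Case1 B (v i) (Ls i) (Rs i) Γ) →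
    (ch : Chain B Δ E) → AvoidsAll v Ls Rs ch → Σ (Chain B Γ E) (AvoidsAll v Ls Rs)
  prepend-reflection {v = v} w {Γ} Bww≡2 Γ≥0 Δ≗sΓ pos case1 ch avoids =
    step cover ch ,
    λ i → (λ Δ≗sᵢΓ → case1 i (reflection-vertex {v = v i} {Γ = Γ} (reflect-difference w Δ≗sΓ) pos Δ≗sᵢΓ)) , avoids i
    where
      posΔ = chain-head ch
      cover = reflection-cover w Bww≡2 (reflRoot w (proj₁ posΔ) (reflect-involutive w Bww≡2 Δ≗sΓ) , Γ≥0)
                               (proj₂ posΔ) Δ≗sΓ pos

  elastic-row : ∀ {v L R} → B v v ≡ ℤ.+ 2 → IsElastic B v L R → ∀ (f : Vect m) u →
                B v u * f u + (if L u then - B v u * f u else 0ℤ) + (if R u then - B v u * f u else 0ℤ) ≡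
                (if u ==ᶠ v then ℤ.+ 2 * f u else 0ℤ)
  elastic-row {v} {L} {R} Bvv≡2 elastic f u with u Fin.≟ v
  ... | yes refl = begin
    B v v * f v + (if L v then - B v v * f v else 0ℤ) + (if R v then - B v v * f v else 0ℤ)
      ≡⟨ cong₂ (λ l r → B v v * f v + (if l then - B v v * f v else 0ℤ) + (if r then - B v v * f v else 0ℤ))
               (elastic-L-self {B = B} elastic) (elastic-R-self {B = B} elastic) ⟩
    B v v * f v + 0ℤ + 0ℤ      ≡⟨ cong (λ b → b * f v + 0ℤ + 0ℤ) Bvv≡2 ⟩
    ℤ.+ 2 * f v + 0ℤ + 0ℤ      ≡⟨ trans (ℤP.+-identityʳ _) (ℤP.+-identityʳ _) ⟩
    ℤ.+ 2 * f v                ∎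
  ... | no u≢v with L u in Lu | R u in Ru
  ...   | true  | true  = contradiction (Lu , Ru) (proj₂ (proj₂ (proj₂ (elastic u))))
  ...   | true  | false = lemma (B v u) (f u)
    where lemma : ∀ b a → b * a + - b * a + 0ℤ ≡ 0ℤ
          lemma = solve-∀
  ...   | false | true  = lemma (B v u) (f u)
    where lemma : ∀ b a → b * a + 0ℤ + - b * a ≡ 0ℤ
          lemma = solve-∀
  ...   | false | false = trans (cong (λ b → b * f u + 0ℤ + 0ℤ) (elastic-outside {B = B} elastic u≢v Lu Ru)) (lemma (f u))
    where lemma : ∀ a → 0ℤ * a + 0ℤ + 0ℤ ≡ 0ℤ
          lemma = solve-∀

  pairing-elastic : ∀ {v L R} → B v v ≡ ℤ.+ 2 → IsElastic B v L R →
                    ∀ f → pairing B v f ≡ ℤ.+ 2 * f v - S B v L f - S B v R f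
  pairing-elastic {v} {L} {R} Bvv≡2 elastic f =
    trans (cancel (pairing B v f) (S B v L f) (S B v R f)) (cong (λ t → t - S B v L f - S B v R f) total)
    where
      cancel : ∀ p a b → p ≡ p + a + b - a - b
      cancel = solve-∀
      sL sR D : Fin m → ℤ
      sL u = if L u then - B v u * f u else 0ℤ
      sR u = if R u then - B v u * f u else 0ℤ
      D u = if u ==ᶠ v then ℤ.+ 2 * f u else 0ℤ
      total : pairing B v f + S B v L f + S B v R f ≡ ℤ.+ 2 * f v
      total = begin
        pairing B v f + S B v L f + S B v R f    ≡⟨ cong (_+ S B v R f) (sym (∑-distrib-+ _ sL)) ⟩
        ∑ (λ u → B v u * f u + sL u) + S B v R f ≡⟨ sym (∑-distrib-+ _ sR) ⟩
        ∑ (λ u → B v u * f u + sL u + sR u)      ≡⟨ ∑-cong (elastic-row Bvv≡2 elastic f) ⟩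
        ∑ D
          ≡⟨ ∑-single v D (λ u u≢v → cong (λ b → if b then ℤ.+ 2 * f u else 0ℤ) (==ᶠ-≢ u≢v)) ⟩
        D v
          ≡⟨ cong (λ b → if b then ℤ.+ 2 * f v else 0ℤ) (==ᶠ-≡ {u = v} refl) ⟩
        ℤ.+ 2 * f v                              ∎

∧-true : ∀ {p q} → p ∧ q ≡ true → q ≡ true
∧-true {true} q≡true = q≡true

-- IsElastic B v L R unfolds to ∀ y → ElasticAt (L y) (R y) (B v y) (y ≡ v).
ElasticAt : Bool → Bool → ℤ → Set → Set
ElasticAt l r e P =
  (l ≡ true → ¬ P × e ≢ 0ℤ) × (r ≡ true → ¬ P × e ≢ 0ℤ) ×
  (¬ P × e ≢ 0ℤ → l ≡ true ⊎ r ≡ true) × ¬ (l ≡ true × r ≡ true)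

ElasticAt-cong : ∀ {l l′ r r′ e e′ P} → l ≡ l′ → r ≡ r′ → e ≡ e′ → ElasticAt l′ r′ e′ P → ElasticAt l r e P
ElasticAt-cong refl refl refl h = h

ElasticAt-if : ∀ {l r : Bool} {w : ℤ} {P : Set} → ¬ P → (l ∨ r ≡ true → w ≢ 0ℤ) → ¬ (l ≡ true × r ≡ true) →
               ElasticAt l r (if l ∨ r then w else 0ℤ) P
ElasticAt-if {true}  {true}  _  _   l∧r = contradiction (refl , refl) l∧r
ElasticAt-if {true}  {false} ¬P w≢0 l∧r = (λ _ → ¬P , w≢0 refl) , (λ ()) , (λ _ → inj₁ refl) , l∧r
ElasticAt-if {false} {true}  ¬P w≢0 l∧r = (λ ()) , (λ _ → ¬P , w≢0 refl) , (λ _ → inj₂ refl) , l∧r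
ElasticAt-if {false} {false} _  _   l∧r = (λ ()) , (λ ()) , (λ (_ , e≢0) → contradiction refl e≢0) , l∧r

ElasticAt-self : ∀ {e : ℤ} {P : Set} → P → ElasticAt false false e P
ElasticAt-self p = (λ ()) , (λ ()) , (λ (¬P , _) → contradiction p ¬P) , (λ ())

-- The stretched diagram

module Stretch {m} (A : Mat m) (cartan : IsCartan A) (x : Fin m) (L R : Fin m → Bool)
               (elastic : IsElastic A x L R) (n : ℕ) where

  B : Mat (m ℕ.+ n)
  B = stA n A x L R

  open RootSystem B
  module Unstretched = RootSystem A

  Vertex : Set
  Vertex = Fin m ⊎ Fin (suc n)

  old : Fin m → Fin (m ℕ.+ n)
  old y = y ↑ˡ n

  x[_] : Fin (suc n) → Fin (m ℕ.+ n)
  x[ k ] = pathV n x k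

  decode-old : ∀ {y} → y ≢ x → decode n x (old y) ≡ inj₁ y
  decode-old {y} y≢x rewrite FinP.splitAt-↑ˡ m y n | ==ᶠ-≢ y≢x = refl

  decode-path : ∀ k → decode n x x[ k ] ≡ inj₂ k
  decode-path zero    rewrite FinP.splitAt-↑ˡ m x n | ==ᶠ-≡ {u = x} refl = refl
  decode-path (suc k) rewrite FinP.splitAt-↑ʳ m n k = refl

  path-injective : ∀ {j k} → x[ j ] ≡ x[ k ] → j ≡ k
  path-injective {j} {k} eq with trans (sym (decode-path j)) (trans (cong (decode n x) eq) (decode-path k))
  ... | refl = refl

  old≢path : ∀ {y k} → y ≢ x → old y ≢ x[ k ]
  old≢path {y} {k} y≢x eq with trans (sym (decode-old y≢x)) (trans (cong (decode n x) eq) (decode-path k))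
  ... | ()

  data View : Fin (m ℕ.+ n) → Set where
    oldᵛ  : ∀ y → y ≢ x → View (old y)
    pathᵛ : ∀ k → View x[ k ]

  view : ∀ u → View u
  view u with Fin.splitAt m u in eq
  ... | inj₂ k = subst View (FinP.splitAt⁻¹-↑ʳ eq) (pathᵛ (suc k))
  ... | inj₁ y with y Fin.≟ x
  ...   | yes refl = subst View (FinP.splitAt⁻¹-↑ˡ eq) (pathᵛ zero)
  ...   | no y≢x   = subst View (FinP.splitAt⁻¹-↑ˡ eq) (oldᵛ y y≢x)

  ∑-decode : ∀ (H : Vertex → ℤ) →
             ∑ (λ u → H (decode n x u)) + H (inj₁ x) ≡ ∑ (λ y → H (inj₁ y)) + ∑ (λ j → H (inj₂ j))
  ∑-decode H = begin
    ∑ (λ u → H (decode n x u)) + H (inj₁ x)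
      ≡⟨ cong (_+ H (inj₁ x)) (∑-↑ m (λ u → H (decode n x u))) ⟩
    ∑ (λ y → H (decode n x (old y))) + ∑ (λ k → H (decode n x (m ↑ʳ k))) + H (inj₁ x)
      ≡⟨ cong (λ s → ∑ (λ y → H (decode n x (old y))) + s + H (inj₁ x)) (∑-cong (λ k → cong H (decode-path (suc k)))) ⟩
    ∑ (λ y → H (decode n x (old y))) + ∑ (λ k → H (inj₂ (suc k))) + H (inj₁ x)
      ≡⟨ swap (∑ (λ y → H (decode n x (old y)))) (∑ (λ k → H (inj₂ (suc k)))) (H (inj₁ x)) ⟩
    ∑ (λ y → H (decode n x (old y))) + H (inj₁ x) + ∑ (λ k → H (inj₂ (suc k)))
      ≡⟨ cong (_+ ∑ (λ k → H (inj₂ (suc k))))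
              (∑-update x (λ y → H (inj₁ y)) (λ y → H (decode n x (old y))) (λ y y≢x → cong H (decode-old y≢x))) ⟩
    ∑ (λ y → H (inj₁ y)) + H (decode n x x[ zero ]) + ∑ (λ k → H (inj₂ (suc k)))
      ≡⟨ cong (λ h → ∑ (λ y → H (inj₁ y)) + h + ∑ (λ k → H (inj₂ (suc k)))) (cong H (decode-path zero)) ⟩
    ∑ (λ y → H (inj₁ y)) + H (inj₂ zero) + ∑ (λ k → H (inj₂ (suc k)))
      ≡⟨ ℤP.+-assoc (∑ (λ y → H (inj₁ y))) _ _ ⟩
    ∑ (λ y → H (inj₁ y)) + ∑ (λ j → H (inj₂ j)) ∎
    where swap : ∀ a b c → a + b + c ≡ a + c + b
          swap = solve-∀

  stA-decoded : Vertex → Vertex → ℤ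
  stA-decoded (inj₁ y) = [ A y , oldPath n A x L R y ]
  stA-decoded (inj₂ i) = [ pathOld n A x L R i , pathPath i ]

  stA-decode : ∀ u w → B u w ≡ stA-decoded (decode n x u) (decode n x w)
  stA-decode u w with decode n x u | decode n x w
  ... | inj₁ y | inj₁ z = refl
  ... | inj₁ y | inj₂ j = refl
  ... | inj₂ i | inj₁ z = refl
  ... | inj₂ i | inj₂ j = refl

  stA-path : ∀ k u → B x[ k ] u ≡ [ pathOld n A x L R k , pathPath k ] (decode n x u)
  stA-path k u = trans (stA-decode x[ k ] u) (cong (λ d → stA-decoded d (decode n x u)) (decode-path k))

  stA-old : ∀ {v} → v ≢ x → ∀ u → B (old v) u ≡ [ A v , oldPath n A x L R v ] (decode n x u)
  stA-old v≢x u = trans (stA-decode (old _) u) (cong (λ d → stA-decoded d (decode n x u)) (decode-old v≢x))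

  stA-path-path : ∀ k j → B x[ k ] x[ j ] ≡ pathPath k j
  stA-path-path k j = trans (stA-path k x[ j ]) (cong [ pathOld n A x L R k , pathPath k ] (decode-path j))

  stA-path-old : ∀ k {y} → y ≢ x → B x[ k ] (old y) ≡ pathOld n A x L R k y
  stA-path-old k y≢x = trans (stA-path k (old _)) (cong [ pathOld n A x L R k , pathPath k ] (decode-old y≢x))

  path-diagonal : ∀ k → B x[ k ] x[ k ] ≡ ℤ.+ 2
  path-diagonal k =
    trans (stA-path-path k k)
          (cong (λ b → if b then ℤ.+ 2 else (if adjⁿ (toℕ k) (toℕ k) then ℤ.-1ℤ else 0ℤ)) (==ⁿ-≡ {toℕ k} refl))

  old-diagonal : ∀ {v} → v ≢ x → B (old v) (old v) ≡ ℤ.+ 2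
  old-diagonal v≢x =
    trans (stA-old v≢x (old _)) (trans (cong [ A _ , oldPath n A x L R _ ] (decode-old v≢x)) (proj₁ cartan _))

  pathPath-off : ∀ {k j : Fin (suc n)} → j ≢ k →
                 pathPath k j ≡ (if (suc (toℕ j) ==ⁿ toℕ k) ∨ (toℕ j ==ⁿ suc (toℕ k)) then ℤ.-1ℤ else 0ℤ)
  pathPath-off {k} {j} j≢k = begin
    pathPath k j
      ≡⟨ cong (λ b → if b then ℤ.+ 2 else (if adjⁿ (toℕ k) (toℕ j) then ℤ.-1ℤ else 0ℤ))
              (==ⁿ-≢ (j≢k ∘ sym ∘ FinP.toℕ-injective)) ⟩
    (if (toℕ k ==ⁿ suc (toℕ j)) ∨ (toℕ j ==ⁿ suc (toℕ k)) then ℤ.-1ℤ else 0ℤ)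
      ≡⟨ cong (λ b → if b ∨ (toℕ j ==ⁿ suc (toℕ k)) then ℤ.-1ℤ else 0ℤ) (==ⁿ-sym (toℕ k) (suc (toℕ j))) ⟩
    (if (suc (toℕ j) ==ⁿ toℕ k) ∨ (toℕ j ==ⁿ suc (toℕ k)) then ℤ.-1ℤ else 0ℤ) ∎

  pathPath-adjacent : ∀ {k j : Fin (suc n)} → suc (toℕ j) ≡ toℕ k ⊎ toℕ j ≡ suc (toℕ k) → pathPath k j ≡ ℤ.-1ℤ
  pathPath-adjacent {k} {j} (inj₁ j+1≡k) =
    trans (pathPath-off j≢k) (cong (λ b → if b ∨ (toℕ j ==ⁿ suc (toℕ k)) then ℤ.-1ℤ else 0ℤ) (==ⁿ-≡ j+1≡k))
    where j≢k : j ≢ k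
          j≢k j≡k = ℕP.1+n≢n (trans (cong (suc ∘ toℕ) (sym j≡k)) j+1≡k)
  pathPath-adjacent {k} {j} (inj₂ j≡k+1) =
    trans (pathPath-off j≢k)
          (cong (λ b → if b then ℤ.-1ℤ else 0ℤ)
                (trans (cong ((suc (toℕ j) ==ⁿ toℕ k) ∨_) (==ⁿ-≡ j≡k+1)) (BoolP.∨-zeroʳ _)))
    where j≢k : j ≢ k
          j≢k j≡k = ℕP.1+n≢n (sym (trans (sym (cong toℕ j≡k)) j≡k+1))

  profile : Vect m → (ℕ → ℤ) → Vect (m ℕ.+ n)
  profile f g u = [ f , g ∘ toℕ ] (decode n x u)

  profile-old : ∀ f g {y} → y ≢ x → profile f g (old y) ≡ f y
  profile-old f g y≢x = cong [ f , g ∘ toℕ ] (decode-old y≢x)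

  profile-path : ∀ f g k → profile f g x[ k ] ≡ g (toℕ k)
  profile-path f g k = cong [ f , g ∘ toℕ ] (decode-path k)

  profile-cong : ∀ {f f′ g g′} → (∀ y → y ≢ x → f y ≡ f′ y) → (∀ (j : Fin (suc n)) → g (toℕ j) ≡ g′ (toℕ j)) →
                 profile f g ≗ profile f′ g′
  profile-cong {f} {f′} {g} {g′} f≡f′ g≡g′ u with view u
  ... | oldᵛ y y≢x = trans (profile-old f g y≢x) (trans (f≡f′ y y≢x) (sym (profile-old f′ g′ y≢x)))
  ... | pathᵛ k    = trans (profile-path f g k) (trans (g≡g′ k) (sym (profile-path f′ g′ k)))

  profile-nonneg : ∀ {f g} → (∀ y → y ≢ x → 0ℤ ℤ.≤ f y) → (∀ j → 0ℤ ℤ.≤ g j) → ∀ u → 0ℤ ℤ.≤ profile f g u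
  profile-nonneg {f} {g} f≥0 g≥0 u with view u
  ... | oldᵛ y y≢x = subst (0ℤ ℤ.≤_) (sym (profile-old f g y≢x)) (f≥0 y y≢x)
  ... | pathᵛ k    = subst (0ℤ ℤ.≤_) (sym (profile-path f g k)) (g≥0 (toℕ k))

  stRoot-profile : ∀ f → stRoot n x f ≗ profile f (λ _ → f x)
  stRoot-profile f u with decode n x u
  ... | inj₁ y = refl
  ... | inj₂ j = refl

  inducedL-decode : ∀ k u →
    inducedL n x L k u ≡ [ (λ z → (toℕ k ==ⁿ 0) ∧ L z) , (λ j → suc (toℕ j) ==ⁿ toℕ k) ] (decode n x u)
  inducedL-decode k u with decode n x u
  ... | inj₁ z = refl
  ... | inj₂ j = refl

  inducedR-decode : ∀ k u →
    inducedR n x R k u ≡ [ (λ z → (toℕ k ==ⁿ n) ∧ R z) , (λ j → toℕ j ==ⁿ suc (toℕ k)) ] (decode n x u)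
  inducedR-decode k u with decode n x u
  ... | inj₁ z = refl
  ... | inj₂ j = refl

  induced-elastic : ∀ k → IsElastic B x[ k ] (inducedL n x L k) (inducedR n x R k)
  induced-elastic k u with view u
  ... | oldᵛ y y≢x =
    ElasticAt-cong (trans (inducedL-decode k (old y)) (cong [ _ , _ ] (decode-old y≢x)))
                   (trans (inducedR-decode k (old y)) (cong [ _ , _ ] (decode-old y≢x)))
                   (stA-path-old k y≢x)
                   (ElasticAt-if (old≢path {k = k} y≢x) neighbour disjoint)
    where
      neighbour : ((toℕ k ==ⁿ 0) ∧ L y) ∨ ((toℕ k ==ⁿ n) ∧ R y) ≡ true → A x y ≢ 0ℤ
      neighbour l∨r with (toℕ k ==ⁿ 0) ∧ L y in l
      ... | true = proj₂ (proj₁ (elastic y) (∧-true l))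
      ... | false = proj₂ (proj₁ (proj₂ (elastic y)) (∧-true l∨r))
      disjoint : ¬ (((toℕ k ==ⁿ 0) ∧ L y) ≡ true × ((toℕ k ==ⁿ n) ∧ R y) ≡ true)
      disjoint (l , r) = proj₂ (proj₂ (proj₂ (elastic y))) (∧-true l , ∧-true r)
  ... | pathᵛ j with j Fin.≟ k
  ...   | yes refl =
    ElasticAt-cong (trans (inducedL-decode k x[ k ]) (trans (cong [ _ , _ ] (decode-path k)) (==ⁿ-≢ ℕP.1+n≢n)))
                   (trans (inducedR-decode k x[ k ]) (trans (cong [ _ , _ ] (decode-path k)) (==ⁿ-≢ (ℕP.1+n≢n ∘ sym))))
                   refl (ElasticAt-self refl)
  ...   | no j≢k =
    ElasticAt-cong (trans (inducedL-decode k x[ j ]) (cong [ _ , _ ] (decode-path j)))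
                   (trans (inducedR-decode k x[ j ]) (cong [ _ , _ ] (decode-path j)))
                   (trans (stA-path-path k j) (pathPath-off j≢k))
                   (ElasticAt-if (j≢k ∘ path-injective {j} {k}) (λ _ ()) disjoint)
    where
      disjoint : ¬ ((suc (toℕ j) ==ⁿ toℕ k) ≡ true × (toℕ j ==ⁿ suc (toℕ k)) ≡ true)
      disjoint (l , r) = ℕP.<-irrefl (trans (==ⁿ⇒≡ _ _ r) (cong suc (sym (==ⁿ⇒≡ _ _ l))))
                                     (ℕP.m<n⇒m<1+n (ℕP.n<1+n (toℕ j)))

  Sᴸ : Vect m → (ℕ → ℤ) → Fin (suc n) → ℤ
  Sᴸ f g zero    = S A x L f
  Sᴸ f g (suc k) = g (toℕ k)

  Sᴿ : Vect m → (ℕ → ℤ) → Fin (suc n) → ℤ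
  Sᴿ f g k with toℕ k ℕ.≟ n
  ... | yes _ = S A x R f
  ... | no _  = g (suc (toℕ k))

  S-path : ∀ f g k (Lk : Fin (m ℕ.+ n) → Bool) (l₁ : Fin m → Bool) (l₂ : Fin (suc n) → Bool) →
           (∀ u → Lk u ≡ [ l₁ , l₂ ] (decode n x u)) → l₁ x ≡ false →
           S B x[ k ] Lk (profile f g) ≡
             ∑ (λ y → if l₁ y then - pathOld n A x L R k y * f y else 0ℤ) +
             ∑ (λ j → if l₂ j then - pathPath k j * g (toℕ j) else 0ℤ)
  S-path f g k Lk l₁ l₂ Lk≡ l₁x≡false = begin
    S B x[ k ] Lk (profile f g)
      ≡⟨ ∑-cong (λ u → cong₂ (λ l e → if l then - e * profile f g u else 0ℤ) (Lk≡ u) (stA-path k u)) ⟩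
    ∑ (λ u → H (decode n x u))
      ≡⟨ sym (trans (cong (∑ (λ u → H (decode n x u)) +_) Hx≡0) (ℤP.+-identityʳ _)) ⟩
    ∑ (λ u → H (decode n x u)) + H (inj₁ x)
      ≡⟨ ∑-decode H ⟩
    ∑ (λ y → H (inj₁ y)) + ∑ (λ j → H (inj₂ j)) ∎
    where
      H : Vertex → ℤ
      H d = if [ l₁ , l₂ ] d then - [ pathOld n A x L R k , pathPath k ] d * [ f , g ∘ toℕ ] d else 0ℤ
      Hx≡0 : H (inj₁ x) ≡ 0ℤ
      Hx≡0 = cong (λ l → if l then - pathOld n A x L R k x * f x else 0ℤ) l₁x≡false

  S-inducedL : ∀ f g k → S B x[ k ] (inducedL n x L k) (profile f g) ≡ Sᴸ f g k
  S-inducedL f g k = begin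
    S B x[ k ] (inducedL n x L k) (profile f g)
      ≡⟨ S-path f g k (inducedL n x L k) (λ z → (toℕ k ==ⁿ 0) ∧ L z) (λ j → suc (toℕ j) ==ⁿ toℕ k) (inducedL-decode k)
                (trans (cong ((toℕ k ==ⁿ 0) ∧_) (elastic-L-self {B = A} elastic)) (BoolP.∧-zeroʳ _)) ⟩
    ∑ (λ y → if (toℕ k ==ⁿ 0) ∧ L y then - pathOld n A x L R k y * f y else 0ℤ) + path k
      ≡⟨ cong (_+ path k) (trans (∑-cong (λ y → old-term (toℕ k ==ⁿ 0) (L y) _ (A x y) (f y)))
                                 (∑-if (toℕ k ==ⁿ 0) (λ y → if L y then - A x y * f y else 0ℤ))) ⟩
    (if toℕ k ==ⁿ 0 then S A x L f else 0ℤ) + path k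
      ≡⟨ evaluate k ⟩
    Sᴸ f g k ∎
    where
      path : Fin (suc n) → ℤ
      path k = ∑ (λ j → if suc (toℕ j) ==ⁿ toℕ k then - pathPath k j * g (toℕ j) else 0ℤ)
      old-term : ∀ b l c a v → (if b ∧ l then - (if (b ∧ l) ∨ c then a else 0ℤ) * v else 0ℤ) ≡
                               (if b then (if l then - a * v else 0ℤ) else 0ℤ)
      old-term false l     c a v = refl
      old-term true  true  c a v = refl
      old-term true  false c a v = refl
      evaluate : ∀ k → (if toℕ k ==ⁿ 0 then S A x L f else 0ℤ) + path k ≡ Sᴸ f g k
      evaluate zero = trans (cong (S A x L f +_) (∑-zero none)) (ℤP.+-identityʳ _)
        where none : ∀ (j : Fin (suc n)) → (if suc (toℕ j) ==ⁿ 0 then - pathPath zero j * g (toℕ j) else 0ℤ) ≡ 0ℤ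
              none j = cong (λ b → if b then - pathPath zero j * g (toℕ j) else 0ℤ) (==ⁿ-≢ (ℕP.1+n≢0 {toℕ j}))
      evaluate (suc k) = begin
        (if suc (toℕ k) ==ⁿ 0 then S A x L f else 0ℤ) + path (suc k)
          ≡⟨ cong₂ _+_ (cong (λ b → if b then S A x L f else 0ℤ) (==ⁿ-≢ (ℕP.1+n≢0 {toℕ k})))
                       (trans (∑-cong (λ j → cong (λ b → if b then - pathPath (suc k) j * g (toℕ j) else 0ℤ)
                                                   (==ⁿ-suc (toℕ j) (toℕ k))))
                              (∑-at (Fin.inject₁ k) (λ j → - pathPath (suc k) j * g (toℕ j)) (FinP.toℕ-inject₁ k))) ⟩
        0ℤ + - pathPath (suc k) (Fin.inject₁ k) * g (toℕ (Fin.inject₁ k))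
          ≡⟨ cong₂ (λ p a → 0ℤ + - p * g a) (pathPath-adjacent (inj₁ (cong suc (FinP.toℕ-inject₁ k))))
                                             (FinP.toℕ-inject₁ k) ⟩
        0ℤ + - ℤ.-1ℤ * g (toℕ k)
          ≡⟨ lemma (g (toℕ k)) ⟩
        g (toℕ k) ∎
        where lemma : ∀ a → 0ℤ + - ℤ.-1ℤ * a ≡ a
              lemma = solve-∀

  S-inducedR : ∀ f g k → S B x[ k ] (inducedR n x R k) (profile f g) ≡ Sᴿ f g k
  S-inducedR f g k = begin
    S B x[ k ] (inducedR n x R k) (profile f g)
      ≡⟨ S-path f g k (inducedR n x R k) (λ z → (toℕ k ==ⁿ n) ∧ R z) (λ j → toℕ j ==ⁿ suc (toℕ k)) (inducedR-decode k)
                (trans (cong ((toℕ k ==ⁿ n) ∧_) (elastic-R-self {B = A} elastic)) (BoolP.∧-zeroʳ _)) ⟩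
    ∑ (λ y → if (toℕ k ==ⁿ n) ∧ R y then - pathOld n A x L R k y * f y else 0ℤ) + path
      ≡⟨ cong (_+ path) (trans (∑-cong (λ y → old-term (toℕ k ==ⁿ 0) (L y) (toℕ k ==ⁿ n) (R y) (A x y) (f y)))
                               (∑-if (toℕ k ==ⁿ n) (λ y → if R y then - A x y * f y else 0ℤ))) ⟩
    (if toℕ k ==ⁿ n then S A x R f else 0ℤ) + path
      ≡⟨ evaluate ⟩
    Sᴿ f g k ∎
    where
      path : ℤ
      path = ∑ (λ j → if toℕ j ==ⁿ suc (toℕ k) then - pathPath k j * g (toℕ j) else 0ℤ)
      old-term : ∀ b l c r a v → (if c ∧ r then - (if (b ∧ l) ∨ (c ∧ r) then a else 0ℤ) * v else 0ℤ) ≡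
                                 (if c then (if r then - a * v else 0ℤ) else 0ℤ)
      old-term b     l     false r     a v = refl
      old-term b     l     true  false a v = refl
      old-term false l     true  true  a v = refl
      old-term true  false true  true  a v = refl
      old-term true  true  true  true  a v = refl
      evaluate : (if toℕ k ==ⁿ n then S A x R f else 0ℤ) + path ≡ Sᴿ f g k
      evaluate with toℕ k ℕ.≟ n
      ... | yes k≡n =
        trans (cong (S A x R f +_) (∑-nowhere (λ j → - pathPath k j * g (toℕ j)) beyond)) (ℤP.+-identityʳ _)
        where beyond : ∀ (j : Fin (suc n)) → toℕ j ≢ suc (toℕ k)
              beyond j j≡k+1 = ℕP.<-irrefl (trans j≡k+1 (cong suc k≡n)) (FinP.toℕ<n j)
      ... | no k≢n = begin
        0ℤ + path
          ≡⟨ cong (0ℤ +_) (∑-at next (λ j → - pathPath k j * g (toℕ j)) (FinP.toℕ-fromℕ< (s≤s k<n))) ⟩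
        0ℤ + - pathPath k next * g (toℕ next)
          ≡⟨ cong₂ (λ p a → 0ℤ + - p * g a) (pathPath-adjacent (inj₂ (FinP.toℕ-fromℕ< (s≤s k<n))))
                                             (FinP.toℕ-fromℕ< (s≤s k<n)) ⟩
        0ℤ + - ℤ.-1ℤ * g (suc (toℕ k))
          ≡⟨ lemma (g (suc (toℕ k))) ⟩
        g (suc (toℕ k)) ∎
        where k<n : toℕ k ℕ.< n
              k<n = ℕP.≤∧≢⇒< (ℕP.≤-pred (FinP.toℕ<n k)) k≢n
              next : Fin (suc n)
              next = Fin.fromℕ< (s≤s k<n)
              lemma : ∀ a → 0ℤ + - ℤ.-1ℤ * a ≡ a
              lemma = solve-∀

  pairing-path : ∀ f g k → pairing B x[ k ] (profile f g) ≡ ℤ.+ 2 * g (toℕ k) - Sᴸ f g k - Sᴿ f g k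
  pairing-path f g k = begin
    pairing B x[ k ] (profile f g)
      ≡⟨ pairing-elastic (path-diagonal k) (induced-elastic k) (profile f g) ⟩
    ℤ.+ 2 * profile f g x[ k ] - S B x[ k ] (inducedL n x L k) (profile f g) - S B x[ k ] (inducedR n x R k) (profile f g)
      ≡⟨ cong₂ _-_ (cong₂ (λ a s → ℤ.+ 2 * a - s) (profile-path f g k) (S-inducedL f g k)) (S-inducedR f g k) ⟩
    ℤ.+ 2 * g (toℕ k) - Sᴸ f g k - Sᴿ f g k ∎

  path-reflect : ∀ f g g′ k → (∀ j → j ≢ k → g′ (toℕ j) ≡ g (toℕ j)) →
                 g′ (toℕ k) ≡ Sᴸ f g k + Sᴿ f g k - g (toℕ k) →
                 profile f g′ ≗ reflect B x[ k ] (profile f g)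
  path-reflect f g g′ k off on u = at (view u)
    where
      at : ∀ {u} → View u → profile f g′ u ≡ reflect B x[ k ] (profile f g) u
      at (oldᵛ y y≢x) = begin
        profile f g′ (old y)                     ≡⟨ trans (profile-old f g′ y≢x) (sym (profile-old f g y≢x)) ⟩
        profile f g (old y)                      ≡⟨ sym (reflect-other x[ k ] (profile f g) (old≢path {k = k} y≢x)) ⟩
        reflect B x[ k ] (profile f g) (old y)   ∎
      at (pathᵛ j) with j Fin.≟ k
      ... | yes refl = begin
        profile f g′ x[ j ]                                         ≡⟨ trans (profile-path f g′ j) on ⟩
        Sᴸ f g j + Sᴿ f g j - g (toℕ j)                             ≡⟨ lemma (Sᴸ f g j) (Sᴿ f g j) (g (toℕ j)) ⟩
        g (toℕ j) - (ℤ.+ 2 * g (toℕ j) - Sᴸ f g j - Sᴿ f g j)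
          ≡⟨ cong₂ _-_ (sym (profile-path f g j)) (sym (pairing-path f g j)) ⟩
        profile f g x[ j ] - pairing B x[ j ] (profile f g)         ≡⟨ sym (reflect-self x[ j ] (profile f g)) ⟩
        reflect B x[ j ] (profile f g) x[ j ]                       ∎
        where lemma : ∀ l r a → l + r - a ≡ a - (ℤ.+ 2 * a - l - r)
              lemma = solve-∀
      ... | no j≢k = begin
        profile f g′ x[ j ]
          ≡⟨ trans (profile-path f g′ j) (trans (off j j≢k) (sym (profile-path f g j))) ⟩
        profile f g x[ j ]                       ≡⟨ sym (reflect-other x[ k ] (profile f g) (j≢k ∘ path-injective {j} {k})) ⟩
        reflect B x[ k ] (profile f g) x[ j ]    ∎

  st-old : ∀ f {y} → y ≢ x → stRoot n x f (old y) ≡ f y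
  st-old f y≢x = trans (stRoot-profile f (old _)) (profile-old f (λ _ → f x) y≢x)

  st-path : ∀ f k → stRoot n x f x[ k ] ≡ f x
  st-path f k = trans (stRoot-profile f x[ k ]) (profile-path f (λ _ → f x) k)

  oldPath-sum : ∀ {v} → v ≢ x → ∀ a → ∑ (λ j → oldPath n A x L R v j * a) ≡ A v x * a
  oldPath-sum {v} v≢x a with L v in Lv | R v in Rv
  ... | true  | true  = contradiction (Lv , Rv) (proj₂ (proj₂ (proj₂ (elastic v))))
  ... | true  | false = trans (∑-cong {suc n} {g = λ j → if toℕ j ==ⁿ 0 then A v x * a else 0ℤ}
                                      (λ j → left (toℕ j ==ⁿ 0) (toℕ j ==ⁿ n)))
                              (∑-at {suc n} zero (λ _ → A v x * a) refl)
    where left : ∀ b c → (if (b ∧ true) ∨ (c ∧ false) then A v x else 0ℤ) * a ≡ (if b then A v x * a else 0ℤ)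
          left true  c     = refl
          left false true  = ℤP.*-zeroˡ a
          left false false = ℤP.*-zeroˡ a
  ... | false | true  = trans (∑-cong {suc n} {g = λ j → if toℕ j ==ⁿ n then A v x * a else 0ℤ}
                                      (λ j → right (toℕ j ==ⁿ 0) (toℕ j ==ⁿ n)))
                              (∑-at (Fin.fromℕ n) (λ _ → A v x * a) (FinP.toℕ-fromℕ n))
    where right : ∀ b c → (if (b ∧ false) ∨ (c ∧ true) then A v x else 0ℤ) * a ≡ (if c then A v x * a else 0ℤ)
          right true  true  = refl
          right false true  = refl
          right true  false = ℤP.*-zeroˡ a
          right false false = ℤP.*-zeroˡ a
  ... | false | false = trans (∑-zero {suc n} (λ j → none (toℕ j ==ⁿ 0) (toℕ j ==ⁿ n)))
                              (sym (trans (cong (_* a) Avx≡0) (ℤP.*-zeroˡ a)))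
    where none : ∀ b c → (if (b ∧ false) ∨ (c ∧ false) then A v x else 0ℤ) * a ≡ 0ℤ
          none true  true  = ℤP.*-zeroˡ a
          none true  false = ℤP.*-zeroˡ a
          none false true  = ℤP.*-zeroˡ a
          none false false = ℤP.*-zeroˡ a
          Avx≡0 : A v x ≡ 0ℤ
          Avx≡0 = proj₂ (proj₂ cartan) x v (elastic-outside {B = A} elastic v≢x Lv Rv)

  pairing-old : ∀ {v} → v ≢ x → ∀ f → pairing B (old v) (stRoot n x f) ≡ pairing A v f
  pairing-old {v} v≢x f =
    trans (cancel (pairing B (old v) (stRoot n x f)) (A v x * f x))
          (trans (cong (_- A v x * f x) total) (sym (cancel (pairing A v f) (A v x * f x))))
    where
      cancel : ∀ p c → p ≡ p + c - c
      cancel = solve-∀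
      H : Vertex → ℤ
      H d = [ A v , oldPath n A x L R v ] d * [ f , (λ _ → f x) ] d
      total : pairing B (old v) (stRoot n x f) + A v x * f x ≡ pairing A v f + A v x * f x
      total = begin
        pairing B (old v) (stRoot n x f) + A v x * f x
          ≡⟨ cong (_+ A v x * f x) (∑-cong (λ u → cong₂ _*_ (stA-old v≢x u) (stRoot-profile f u))) ⟩
        ∑ (λ u → H (decode n x u)) + H (inj₁ x)
          ≡⟨ ∑-decode H ⟩
        pairing A v f + ∑ (λ j → oldPath n A x L R v j * f x)
          ≡⟨ cong (pairing A v f +_) (oldPath-sum v≢x (f x)) ⟩
        pairing A v f + A v x * f x ∎

  old-reflect : ∀ {v} → v ≢ x → ∀ {γ δ} → δ ≗ reflect A v γ → stRoot n x δ ≗ reflect B (old v) (stRoot n x γ)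
  old-reflect {v} v≢x {γ} {δ} δ≗sγ u = at (view u)
    where
      at : ∀ {u} → View u → stRoot n x δ u ≡ reflect B (old v) (stRoot n x γ) u
      at (oldᵛ y y≢x) = begin
        stRoot n x δ (old y)          ≡⟨ trans (st-old δ y≢x) (δ≗sγ y) ⟩
        γ y - pairing A v γ * simple v y
          ≡⟨ cong₂ (λ a ps → a - ps) (sym (st-old γ y≢x))
                   (cong₂ _*_ (sym (pairing-old v≢x γ)) (sym (simple-↑ˡ n y v))) ⟩
        reflect B (old v) (stRoot n x γ) (old y) ∎
      at (pathᵛ j) = begin
        stRoot n x δ x[ j ]                      ≡⟨ trans (st-path δ j) (δ≗sγ x) ⟩
        reflect A v γ x                          ≡⟨ Unstretched.reflect-other v γ (v≢x ∘ sym) ⟩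
        γ x                                      ≡⟨ sym (st-path γ j) ⟩
        stRoot n x γ x[ j ]                      ≡⟨ sym (reflect-other (old v) (stRoot n x γ) (old≢path {k = j} v≢x ∘ sym)) ⟩
        reflect B (old v) (stRoot n x γ) x[ j ]  ∎

  stRoot-cong : ∀ {α β} → α ≗ β → stRoot n x α ≗ stRoot n x β
  stRoot-cong α≗β u with decode n x u
  ... | inj₁ y = α≗β y
  ... | inj₂ _ = α≗β x

  st-pos : ∀ {α} → (∀ u → 0ℤ ℤ.≤ α u) → ∀ u → 0ℤ ℤ.≤ stRoot n x α u
  st-pos {α} α≥0 u = subst (0ℤ ℤ.≤_) (sym (stRoot-profile α u)) (profile-nonneg (λ y _ → α≥0 y) (λ _ → α≥0 x) u)

  st≗profile : ∀ {h} f g → (∀ y → y ≢ x → h y ≡ f y) → (∀ (j : Fin (suc n)) → h x ≡ g (toℕ j)) →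
               stRoot n x h ≗ profile f g
  st≗profile {h} f g h≡f hx≡g u = trans (stRoot-profile h u) (profile-cong {g′ = g} h≡f hx≡g u)

  cut : ℕ → ℤ → ℤ → ℕ → ℤ
  cut K b c j = if j ℕ.<ᵇ K then b else c

  cut-below : ∀ {K b c j} → j ℕ.< K → cut K b c j ≡ b
  cut-below {b = b} {c} j<K = cong (λ t → if t then b else c) (<ᵇ-true j<K)

  cut-above : ∀ {K b c j} → K ≤ j → cut K b c j ≡ c
  cut-above {b = b} {c} K≤j = cong (λ t → if t then b else c) (<ᵇ-false K≤j)

  cut-nonneg : ∀ K {b c} → 0ℤ ℤ.≤ b → 0ℤ ℤ.≤ c → ∀ j → 0ℤ ℤ.≤ cut K b c j
  cut-nonneg K b≥0 c≥0 j with j ℕ.<ᵇ K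
  ... | true  = b≥0
  ... | false = c≥0

  cut-index : ∀ f {K K′ b c} → K ≡ K′ → profile f (cut K b c) ≗ profile f (cut K′ b c)
  cut-index f refl u = refl

  Sᴸ-cut : ∀ {f b c K} k → S A x L f ≡ b → toℕ k ≤ K → Sᴸ f (cut K b c) k ≡ b
  Sᴸ-cut zero    SL≡b _   = SL≡b
  Sᴸ-cut (suc k) _    k<K = cut-below k<K

  Sᴿ-last : ∀ f g k → toℕ k ≡ n → Sᴿ f g k ≡ S A x R f
  Sᴿ-last f g k k≡n with toℕ k ℕ.≟ n
  ... | yes _   = refl
  ... | no k≢n = contradiction k≡n k≢n

  Sᴿ-cut : ∀ {f b c K} k → (toℕ k ≡ n → S A x R f ≡ c) → K ≤ suc (toℕ k) → Sᴿ f (cut K b c) k ≡ c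
  Sᴿ-cut k SR≡c K≤k+1 with toℕ k ℕ.≟ n
  ... | yes k≡n = SR≡c k≡n
  ... | no _    = cut-above K≤k+1

  AvoidsInduced : ∀ {Γ E : Vect (m ℕ.+ n)} → Chain B Γ E → Set
  AvoidsInduced = AvoidsAll x[_] (inducedL n x L) (inducedR n x R)

  Case1-only-at : ∀ {Γ} k → Case1 B x[ k ] (inducedL n x L k) (inducedR n x R k) Γ →
                  ∀ i → x[ i ] ≡ x[ k ] → Case1 B x[ i ] (inducedL n x L i) (inducedR n x R i) Γ
  Case1-only-at k case1 i eq with path-injective {i} {k} eq
  ... | refl = case1

  module CutStep (f : Vect m) {b c : ℤ} (SL≡b : S A x L f ≡ b) (k : Fin (suc n))
                 (SR≡c : toℕ k ≡ n → S A x R f ≡ c) where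

    upper lower : ℕ → ℤ
    upper = cut (suc (toℕ k)) b c
    lower = cut (toℕ k) b c

    upper-here : upper (toℕ k) ≡ b
    upper-here = cut-below (ℕP.n<1+n (toℕ k))

    lower-here : lower (toℕ k) ≡ c
    lower-here = cut-above {toℕ k} ℕP.≤-refl

    Sᴸ-upper : Sᴸ f upper k ≡ b
    Sᴸ-upper = Sᴸ-cut k SL≡b (ℕP.n≤1+n (toℕ k))

    Sᴸ-lower : Sᴸ f lower k ≡ b
    Sᴸ-lower = Sᴸ-cut k SL≡b ℕP.≤-refl

    Sᴿ-upper : Sᴿ f upper k ≡ c
    Sᴿ-upper = Sᴿ-cut k SR≡c ℕP.≤-refl

    Sᴿ-lower : Sᴿ f lower k ≡ c
    Sᴿ-lower = Sᴿ-cut k SR≡c (ℕP.n≤1+n (toℕ k))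

    agree : ∀ j → j ≢ k → lower (toℕ j) ≡ upper (toℕ j)
    agree j j≢k with ℕP.<-cmp (toℕ j) (toℕ k)
    ... | tri< j<k _ _ = trans (cut-below j<k) (sym (cut-below (ℕP.m<n⇒m<1+n j<k)))
    ... | tri≈ _ j≡k _ = contradiction (FinP.toℕ-injective j≡k) j≢k
    ... | tri> _ _ k<j = trans (cut-above (ℕP.<⇒≤ k<j)) (sym (cut-above k<j))

    lower-reflect : profile f lower ≗ reflect B x[ k ] (profile f upper)
    lower-reflect = path-reflect f upper lower k agree (begin
      lower (toℕ k)                                   ≡⟨ lower-here ⟩
      c                                               ≡⟨ lemma b c ⟩
      b + c - b
        ≡⟨ sym (cong₂ (λ s a → s - a) (cong₂ _+_ Sᴸ-upper Sᴿ-upper) upper-here) ⟩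
      Sᴸ f upper k + Sᴿ f upper k - upper (toℕ k) ∎)
      where lemma : ∀ b c → c ≡ b + c - b
            lemma = solve-∀

    upper-reflect : profile f upper ≗ reflect B x[ k ] (profile f lower)
    upper-reflect = path-reflect f lower upper k (λ j j≢k → sym (agree j j≢k)) (begin
      upper (toℕ k)                                   ≡⟨ upper-here ⟩
      b                                               ≡⟨ lemma b c ⟩
      b + c - c
        ≡⟨ sym (cong₂ (λ s a → s - a) (cong₂ _+_ Sᴸ-lower Sᴿ-lower) lower-here) ⟩
      Sᴸ f lower k + Sᴿ f lower k - lower (toℕ k) ∎)
      where lemma : ∀ b c → b ≡ b + c - c
            lemma = solve-∀

    pairing-upper : pairing B x[ k ] (profile f upper) ≡ b - c
    pairing-upper = begin
      pairing B x[ k ] (profile f upper)                       ≡⟨ pairing-path f upper k ⟩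
      ℤ.+ 2 * upper (toℕ k) - Sᴸ f upper k - Sᴿ f upper k
        ≡⟨ cong₂ _-_ (cong₂ (λ a s → ℤ.+ 2 * a - s) upper-here Sᴸ-upper) Sᴿ-upper ⟩
      ℤ.+ 2 * b - b - c                                        ≡⟨ lemma b c ⟩
      b - c                                                    ∎
      where lemma : ∀ b c → ℤ.+ 2 * b - b - c ≡ b - c
            lemma = solve-∀

    pairing-lower : pairing B x[ k ] (profile f lower) ≡ c - b
    pairing-lower = begin
      pairing B x[ k ] (profile f lower)                       ≡⟨ pairing-path f lower k ⟩
      ℤ.+ 2 * lower (toℕ k) - Sᴸ f lower k - Sᴿ f lower k
        ≡⟨ cong₂ _-_ (cong₂ (λ a s → ℤ.+ 2 * a - s) lower-here Sᴸ-lower) Sᴿ-lower ⟩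
      ℤ.+ 2 * c - b - c                                        ≡⟨ lemma b c ⟩
      c - b                                                    ∎
      where lemma : ∀ b c → ℤ.+ 2 * c - b - c ≡ c - b
            lemma = solve-∀

    Case1-upper : Case1 B x[ k ] (inducedL n x L k) (inducedR n x R k) (profile f upper)
    Case1-upper = inj₁ (trans (S-inducedL f upper k) (trans Sᴸ-upper (sym (trans (profile-path f upper k) upper-here))))

    Case1-lower : Case1 B x[ k ] (inducedL n x L k) (inducedR n x R k) (profile f lower)
    Case1-lower = inj₂ (trans (S-inducedR f lower k) (trans Sᴿ-lower (sym (trans (profile-path f lower k) lower-here))))

    descend : ∀ {Γ Δ E} → (∀ u → 0ℤ ℤ.≤ Γ u) → 0ℤ ℤ.< b - c → Γ ≗ profile f upper → Δ ≗ profile f lower →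
              (ch : Chain B Δ E) → AvoidsInduced ch → Σ (Chain B Γ E) AvoidsInduced
    descend Γ≥0 pos Γ≗ Δ≗ =
      prepend-reflection x[ k ] (path-diagonal k) Γ≥0
        (λ u → trans (Δ≗ u) (trans (lower-reflect u) (sym (reflect-cong x[ k ] Γ≗ u))))
        (subst (0ℤ ℤ.<_) (sym (trans (pairing-cong x[ k ] Γ≗) pairing-upper)) pos)
        (Case1-only-at k (Case1-cong x[ k ] _ _ Γ≗ Case1-upper))

    ascend : ∀ {Γ Δ E} → (∀ u → 0ℤ ℤ.≤ Γ u) → 0ℤ ℤ.< c - b → Γ ≗ profile f lower → Δ ≗ profile f upper →
             (ch : Chain B Δ E) → AvoidsInduced ch → Σ (Chain B Γ E) AvoidsInduced
    ascend Γ≥0 pos Γ≗ Δ≗ =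
      prepend-reflection x[ k ] (path-diagonal k) Γ≥0
        (λ u → trans (Δ≗ u) (trans (upper-reflect u) (sym (reflect-cong x[ k ] Γ≗ u))))
        (subst (0ℤ ℤ.<_) (sym (trans (pairing-cong x[ k ] Γ≗) pairing-lower)) pos)
        (Case1-only-at k (Case1-cong x[ k ] _ _ Γ≗ Case1-lower))

  inject₁-not-last : ∀ {P : Set} (i : Fin n) → toℕ (Fin.inject₁ i) ≡ n → P
  inject₁-not-last i eq = contradiction (sym eq) (FinP.toℕ-inject₁-≢ i)

  cut-roots-down : ∀ f {b c} → S A x L f ≡ b →
                   ∀ k → IsRoot B (profile f (cut (toℕ k) b c)) → IsRoot B (profile f (cut 0 b c))
  cut-roots-down f {b} {c} SL≡b = <-weakInduction P (λ r → r) next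
    where
      P : Fin (suc n) → Set
      P k = IsRoot B (profile f (cut (toℕ k) b c)) → IsRoot B (profile f (cut 0 b c))
      next : ∀ i → P (Fin.inject₁ i) → P (suc i)
      next i rec r = rec (reflRoot x[ Fin.inject₁ i ]
                                   (IsRoot-cong r (cut-index f (cong suc (FinP.toℕ-inject₁ i))))
                                   (CutStep.lower-reflect f SL≡b (Fin.inject₁ i) (inject₁-not-last i)))

  cut-roots-up : ∀ f {b c} → S A x L f ≡ b →
                 IsRoot B (profile f (cut 0 b c)) → ∀ k → IsRoot B (profile f (cut (toℕ k) b c))
  cut-roots-up f {b} {c} SL≡b r₀ = <-weakInduction P r₀ next
    where
      P : Fin (suc n) → Set
      P k = IsRoot B (profile f (cut (toℕ k) b c))
      next : ∀ i → P (Fin.inject₁ i) → P (suc i)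
      next i r = IsRoot-cong (reflRoot x[ Fin.inject₁ i ] r
                                       (CutStep.upper-reflect f SL≡b (Fin.inject₁ i) (inject₁-not-last i)))
                             (cut-index f (cong suc (sym (FinP.toℕ-inject₁ i))))

  pairing-x : ∀ f → pairing A x f ≡ ℤ.+ 2 * f x - S A x L f - S A x R f
  pairing-x = Unstretched.pairing-elastic (proj₁ cartan x) elastic

  reflect-x : ∀ γ → reflect A x γ x ≡ S A x L γ + S A x R γ - γ x
  reflect-x γ = trans (Unstretched.reflect-self x γ) (trans (cong (λ p → γ x - p) (pairing-x γ)) (lemma (γ x) _ _))
    where lemma : ∀ a l r → a - (ℤ.+ 2 * a - l - r) ≡ l + r - a
          lemma = solve-∀

  last : Fin (suc n)
  last = Fin.fromℕ n

  below-last : ∀ {j : Fin (suc n)} → j ≢ last → toℕ j ℕ.< toℕ last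
  below-last {j} j≢last = subst (toℕ j ℕ.<_) (sym (FinP.toℕ-fromℕ n))
    (ℕP.≤∧≢⇒< (ℕP.≤-pred (FinP.toℕ<n j))
              (j≢last ∘ λ j≡n → FinP.toℕ-injective (trans j≡n (sym (FinP.toℕ-fromℕ n)))))

  st-after-x : ∀ {γ δ} → δ ≗ reflect A x γ → stRoot n x δ ≗ profile γ (λ _ → S A x L γ + S A x R γ - γ x)
  st-after-x {γ} δ≗sγ = st≗profile γ _ (λ y y≢x → trans (δ≗sγ y) (Unstretched.reflect-other x γ y≢x))
                                       (λ _ → trans (δ≗sγ x) (reflect-x γ))

  st-simple-old : ∀ {i β} → i ≢ x → β ≗ simple i → stRoot n x β ≗ simple (old i)
  st-simple-old {i} {β} i≢x β≗αᵢ u = at (view u)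
    where
      at : ∀ {u} → View u → stRoot n x β u ≡ simple (old i) u
      at (oldᵛ y y≢x) = trans (st-old β y≢x) (trans (β≗αᵢ y) (sym (simple-↑ˡ n y i)))
      at (pathᵛ k)    = begin
        stRoot n x β x[ k ]  ≡⟨ trans (st-path β k) (β≗αᵢ x) ⟩
        simple i x           ≡⟨ simple-≢ (i≢x ∘ sym) ⟩
        0ℤ                   ≡⟨ sym (simple-≢ (old≢path {k = k} i≢x ∘ sym)) ⟩
        simple (old i) x[ k ] ∎

  st-simple-x : ∀ {β} → β ≗ simple x → IsRoot B (stRoot n x β)
  st-simple-x {β} β≗αₓ =
    IsRoot-cong (cut-roots-down β SL≡0 last (simpleRoot x[ last ] (λ u → at (view u))))
                (st≗profile β (cut 0 0ℤ 1ℤ) (λ _ _ → refl) (λ _ → trans (β≗αₓ x) (simple-self x)))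
    where
      SL≡0 : S A x L β ≡ 0ℤ
      SL≡0 = trans (Unstretched.S-cong x L β≗αₓ) (Unstretched.S-simple elastic)
      g = cut (toℕ last) 0ℤ 1ℤ
      at : ∀ {u} → View u → profile β g u ≡ simple x[ last ] u
      at (oldᵛ y y≢x) = begin
        profile β g (old y)     ≡⟨ trans (profile-old β g y≢x) (β≗αₓ y) ⟩
        simple x y              ≡⟨ simple-≢ y≢x ⟩
        0ℤ                      ≡⟨ sym (simple-≢ (old≢path {k = last} y≢x)) ⟩
        simple x[ last ] (old y) ∎
      at (pathᵛ j) with j Fin.≟ last
      ... | yes refl  = trans (profile-path β g j) (trans (cut-above {toℕ j} ℕP.≤-refl) (sym (simple-self x[ j ])))
      ... | no j≢last = trans (profile-path β g j)
                              (trans (cut-below (below-last j≢last)) (sym (simple-≢ (j≢last ∘ path-injective {j} {last}))))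

  st-reflect-x : ∀ {γ δ} → IsRoot B (stRoot n x γ) → δ ≗ reflect A x γ → IsRoot B (stRoot n x δ)
  st-reflect-x {γ} {δ} rγ δ≗sγ = IsRoot-cong (cut-roots-down γ refl last phase₂) (st-after-x δ≗sγ)
    where
      sl = S A x L γ
      sr = S A x R γ
      a  = γ x
      a′ = sl + sr - a
      g g′ : ℕ → ℤ
      g  = cut (toℕ last) sl a
      g′ = cut (toℕ last) sl a′
      phase₁ : IsRoot B (profile γ g)
      phase₁ = cut-roots-up γ refl (IsRoot-cong rγ (λ u → sym (st≗profile γ (cut 0 sl a) (λ _ _ → refl) (λ _ → refl) u)))
                            last
      on : g′ (toℕ last) ≡ Sᴸ γ g last + Sᴿ γ g last - g (toℕ last)
      on = begin
        g′ (toℕ last)                             ≡⟨ cut-above {toℕ last} ℕP.≤-refl ⟩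
        sl + sr - a                               ≡⟨ sym (cong₂ _-_ (cong₂ _+_ (Sᴸ-cut last refl ℕP.≤-refl)
                                                                               (Sᴿ-last γ g last (FinP.toℕ-fromℕ n)))
                                                                   (cut-above {toℕ last} ℕP.≤-refl)) ⟩
        Sᴸ γ g last + Sᴿ γ g last - g (toℕ last) ∎
      off : ∀ j → j ≢ last → g′ (toℕ j) ≡ g (toℕ j)
      off j j≢last = trans (cut-below (below-last j≢last)) (sym (cut-below (below-last j≢last)))
      phase₂ : IsRoot B (profile γ g′)
      phase₂ = reflRoot x[ last ] phase₁ (path-reflect γ g g′ last off on)

  st-root : ∀ {β} → IsRoot A β → IsRoot B (stRoot n x β)
  st-root (simpleRoot i β≗αᵢ) with i Fin.≟ x
  ... | no i≢x   = simpleRoot (old i) (st-simple-old i≢x β≗αᵢ)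
  ... | yes refl = st-simple-x β≗αᵢ
  st-root (reflRoot i r δ≗sᵢγ) with i Fin.≟ x
  ... | no i≢x   = reflRoot (old i) (st-root r) (old-reflect i≢x δ≗sᵢγ)
  ... | yes refl = st-reflect-x (st-root r) δ≗sᵢγ

  module Sweep (f : Vect m) (f≥0 : ∀ y → y ≢ x → 0ℤ ℤ.≤ f y) {b c : ℤ} (b≥0 : 0ℤ ℤ.≤ b) (c≥0 : 0ℤ ℤ.≤ c)
               (SL≡b : S A x L f ≡ b) (SR≡c : S A x R f ≡ c)
               {T E : Vect (m ℕ.+ n)} (ch : Chain B T E) (avoids : AvoidsInduced ch) where

    module Step k = CutStep f SL≡b k (λ _ → SR≡c)

    cut≥0 : ∀ {Γ} K → Γ ≗ profile f (cut K b c) → ∀ u → 0ℤ ℤ.≤ Γ u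
    cut≥0 K Γ≗ u = subst (0ℤ ℤ.≤_) (sym (Γ≗ u)) (profile-nonneg f≥0 (cut-nonneg K b≥0 c≥0) u)

    sweep-down : 0ℤ ℤ.< b - c → T ≗ profile f (cut 0 b c) →
                 ∀ {Γ} → Γ ≗ profile f (cut (suc n) b c) → Σ (Chain B Γ E) AvoidsInduced
    sweep-down pos T≗ Γ≗ = <-weakInduction P base next last
                             (λ u → trans (Γ≗ u) (cut-index f (cong suc (sym (FinP.toℕ-fromℕ n))) u))
      where
        P : Fin (suc n) → Set
        P k = ∀ {Γ} → Γ ≗ profile f (cut (suc (toℕ k)) b c) → Σ (Chain B Γ E) AvoidsInduced
        base : P zero
        base Γ≗ = Step.descend zero (cut≥0 1 Γ≗) pos Γ≗ T≗ ch avoids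
        next : ∀ i → P (Fin.inject₁ i) → P (suc i)
        next i rec Γ≗ =
          let ch′ , avoids′ = rec (cut-index f (cong suc (sym (FinP.toℕ-inject₁ i))))
          in Step.descend (suc i) (cut≥0 (suc (toℕ (suc i))) Γ≗) pos Γ≗ (λ _ → refl) ch′ avoids′

    sweep-up : 0ℤ ℤ.< c - b → T ≗ profile f (cut (suc n) b c) →
               ∀ {Γ} → Γ ≗ profile f (cut 0 b c) → Σ (Chain B Γ E) AvoidsInduced
    sweep-up pos T≗ = >-weakInduction P base next zero
      where
        P : Fin (suc n) → Set
        P k = ∀ {Γ} → Γ ≗ profile f (cut (toℕ k) b c) → Σ (Chain B Γ E) AvoidsInduced
        base : P last
        base Γ≗ = Step.ascend last (cut≥0 (toℕ last) Γ≗) pos Γ≗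
                    (λ u → trans (T≗ u) (cut-index f (cong suc (sym (FinP.toℕ-fromℕ n))) u)) ch avoids
        next : ∀ i → P (suc i) → P (Fin.inject₁ i)
        next i rec Γ≗ =
          let ch′ , avoids′ = rec (cut-index f (cong suc (FinP.toℕ-inject₁ i)))
          in Step.ascend (Fin.inject₁ i) (cut≥0 (toℕ (Fin.inject₁ i)) Γ≗) pos Γ≗ (λ _ → refl) ch′ avoids′

  lift-old-step : ∀ {v γ δ E} → v ≢ x → (∀ u → 0ℤ ℤ.≤ γ u) → δ ≗ reflect A v γ → 0ℤ ℤ.< pairing A v γ →
                  (ch : Chain B (stRoot n x δ) E) → AvoidsInduced ch → Σ (Chain B (stRoot n x γ) E) AvoidsInduced
  lift-old-step {v} {γ} v≢x γ≥0 δ≗sγ pos =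
    prepend-reflection (old v) (old-diagonal v≢x) (st-pos γ≥0) (old-reflect v≢x δ≗sγ)
      (subst (0ℤ ℤ.<_) (sym (pairing-old v≢x γ)) pos)
      (λ i path≡old → contradiction (sym path≡old) (old≢path {k = i} v≢x))

  lift-x-step : ∀ {γ δ E} → (∀ u → 0ℤ ℤ.≤ γ u) → 0ℤ ℤ.≤ δ x → δ ≗ reflect A x γ → 0ℤ ℤ.< pairing A x γ →
                Case1 A x L R γ → (ch : Chain B (stRoot n x δ) E) → AvoidsInduced ch →
                Σ (Chain B (stRoot n x γ) E) AvoidsInduced
  lift-x-step {γ} {δ} γ≥0 δx≥0 δ≗sγ pos (inj₁ sl≡a) ch avoids =
    Sweep.sweep-down γ (λ y _ → γ≥0 y) (subst (0ℤ ℤ.≤_) (sym sl≡a) (γ≥0 x))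
      (subst (0ℤ ℤ.≤_) (trans (δ≗sγ x) (trans (reflect-x γ) reflected≡sr)) δx≥0) refl refl ch avoids
      (subst (0ℤ ℤ.<_) (trans (pairing-x γ) (sym difference)) pos)
      (λ u → trans (st-after-x δ≗sγ u) (profile-cong {g′ = cut 0 sl sr} (λ _ _ → refl) (λ _ → reflected≡sr) u))
      (st≗profile γ (cut (suc n) sl sr) (λ _ _ → refl) (λ j → trans (sym sl≡a) (sym (cut-below (FinP.toℕ<n j)))))
    where
      sl = S A x L γ
      sr = S A x R γ
      a  = γ x
      reflected≡sr : sl + sr - a ≡ sr
      reflected≡sr = trans (cong (λ l → l + sr - a) sl≡a) (lemma a sr)
        where lemma : ∀ a r → a + r - a ≡ r
              lemma = solve-∀
      difference : sl - sr ≡ ℤ.+ 2 * a - sl - sr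
      difference = trans (cong (_- sr) sl≡a) (trans (lemma a sr) (cong (λ l → ℤ.+ 2 * a - l - sr) (sym sl≡a)))
        where lemma : ∀ a r → a - r ≡ ℤ.+ 2 * a - a - r
              lemma = solve-∀
  lift-x-step {γ} {δ} γ≥0 δx≥0 δ≗sγ pos (inj₂ sr≡a) ch avoids =
    Sweep.sweep-up γ (λ y _ → γ≥0 y) (subst (0ℤ ℤ.≤_) (trans (δ≗sγ x) (trans (reflect-x γ) reflected≡sl)) δx≥0)
      (subst (0ℤ ℤ.≤_) (sym sr≡a) (γ≥0 x)) refl refl ch avoids
      (subst (0ℤ ℤ.<_) (trans (pairing-x γ) (sym difference)) pos)
      (λ u → trans (st-after-x δ≗sγ u)
                    (profile-cong {g′ = cut (suc n) sl sr} (λ _ _ → refl)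
                                  (λ j → trans reflected≡sl (sym (cut-below (FinP.toℕ<n j)))) u))
      (st≗profile γ (cut 0 sl sr) (λ _ _ → refl) (λ _ → sym sr≡a))
    where
      sl = S A x L γ
      sr = S A x R γ
      a  = γ x
      reflected≡sl : sl + sr - a ≡ sl
      reflected≡sl = trans (cong (λ r → sl + r - a) sr≡a) (lemma sl a)
        where lemma : ∀ l a → l + a - a ≡ l
              lemma = solve-∀
      difference : sr - sl ≡ ℤ.+ 2 * a - sl - sr
      difference = trans (cong (_- sl) sr≡a) (trans (lemma a sl) (cong (λ r → ℤ.+ 2 * a - sl - r) (sym sr≡a)))
        where lemma : ∀ a l → a - l ≡ ℤ.+ 2 * a - l - a
              lemma = solve-∀

  lift-cover : ∀ {γ δ E} → Covers A γ δ → (δ ≗ reflect A x γ → Case1 A x L R γ) →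
               (ch : Chain B (stRoot n x δ) E) → AvoidsInduced ch → Σ (Chain B (stRoot n x γ) E) AvoidsInduced
  lift-cover ((_ , γ≥0) , (_ , δ≥0) , v , γ≗sδ , _ , c>0 , diff) case1
    with Unstretched.cover-reflection v (proj₁ cartan v) γ≗sδ diff c>0 | v Fin.≟ x
  ... | δ≗sγ , pos | no v≢x   = lift-old-step v≢x γ≥0 δ≗sγ pos
  ... | δ≗sγ , pos | yes refl = lift-x-step γ≥0 (δ≥0 x) δ≗sγ pos (case1 δ≗sγ)

  lift-chain : ∀ {α β} (ch : Chain A α β) → Avoids A x L R ch →
               Σ (Chain B (stRoot n x α) (stRoot n x β)) AvoidsInduced
  lift-chain (done (rα , α≥0) α≗β) _ = done (st-root rα , st-pos α≥0) (stRoot-cong α≗β) , λ _ → tt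
  lift-chain (step cover ch) (case1 , avoids) =
    let ch′ , avoids′ = lift-chain ch avoids in lift-cover cover case1 ch′ avoids′

lemma4p7 : ∀ {m} (A : Mat m) → IsCartan A →
    (x : Fin m) (L R : Fin m → Bool) → IsElastic A x L R →
    (α β : Vect m) → PosRoot A α → PosRoot A β →
    (ch : Chain A α β) → Avoids A x L R ch →
    (n : ℕ) → 1 ≤ n →
    Σ (Chain (stA n A x L R) (stRoot n x α) (stRoot n x β)) λ ch′ →
      (i : Fin (suc n)) →
        Avoids (stA n A x L R) (pathV n x i) (inducedL n x L i) (inducedR n x R i) ch′
lemma4p7 A cartan x L R elastic α β _ _ ch avoids n _ = Stretch.lift-chain A cartan x L R elastic n ch avoids
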